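{- Let $n\ge3$ and let $\mathcal M=(G,\mathit{In},\mathit{Out},\mathit{Leak})$ be an $n$-compartment directed-cycle model with $\mathit{In}\ne\emptyset$, $\mathit{Out}\ne\emptyset$ and $\mathit{Leak}\ne\emptyset$. Write $k_{n+1,n}:=k_{1n}$ and take compartment indices mod $n$. Then: (1) The coefficient map of $\mathcal M$ contains the coefficients $e_1,e_2,\dots,e_{n-1}$ and $e_n-\prod_{i=1}^n k_{i+1,i}$, where $e_j$ is the $j$-th elementary symmetric polynomial on the set $E=\{k_{i+1,i}: i\notin\mathit{Leak}\}\cup\{k_{i+1,i}+k_{0i}: i\in\mathit{Leak}\}$. (2) For all $i\in\mathit{In}$ and $j\in\mathit{Out}$, the coefficient map contains the coefficient $\kappa(i,j)$, defined as $k_{i+1,i}k_{i+2,i+1}\cdots k_{j,j-1}$ (indices mod $n$) if $i\ne j$, and as $1$ if $i=j$. (3) For all $i\in\mathit{In}$ and $j\in\mathit{Out}$ with $j\ne i-1\pmod n$, the coefficient map contains the coefficient $e_1^*(i,j)\,\kappa(i,j)$, where $$e_1^*(i,j)=\sum_{q\in\{j+1,\dots,i-1\}\setminus\mathit{Leak}}k_{q+1,q}+\sum_{q\in\{j+1,\dots,i-1\}\cap\mathit{Leak}}(k_{q+1,q}+k_{0q}),$$ with the indices $j+1,j+2,\dots,i-1$ taken mod $n$.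
   Context: A linear compartmental model $\mathcal M=(G,\mathit{In},\mathit{Out},\mathit{Leak})$ consists of a finite directed graph $G=(V,E)$, $V=\{1,\dots,n\}$, with subsets $\mathit{In},\mathit{Out},\mathit{Leak}\subseteq V$. Each edge $j\to i$ carries a parameter $k_{ij}$ and each $\ell\in\mathit{Leak}$ a parameter $k_{0\ell}$. The compartmental matrix $A$ has $a_{ii}=-\sum_{p:\,i\to p\in E}k_{pi}$ (additionally $-k_{0i}$ if $i\in\mathit{Leak}$), $a_{ij}=k_{ij}$ if $j\to i\in E$, $a_{ij}=0$ otherwise ($i\ne j$). For each $i\in\mathit{Out}$ the input-output equation is $\det(\partial I-A)\,y_i=\sum_{j\in\mathit{In}}(-1)^{i+j}\det[(\partial I-A)^{j,i}]\,u_j$, with $\partial=d/dt$ and $B^{j,i}$ the matrix $B$ with row $j$ and column $i$ removed. Expanded, the coefficients of the derivatives $y_i^{(d)}$ and $u_j^{(d)}$ are polynomials in the parameters; the coefficient map of $\mathcal M$ is the vector of these coefficients over all $i\in\mathit{Out}$ (containing all non-constant ones). A directed-cycle model has $n\ge3$, $V=\{1,\dots,n\}$ and $E=\{1\to2,2\to3,\dots,(n-1)\to n,n\to1\}$, so the edge parameters are $k_{21},k_{32},\dots,k_{n,n-1},k_{1n}$. -}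

module Defs where

open import Level using (0ℓ)
open import Function using (_∘_)
open import Algebra.Bundles using (CommutativeRing)
open import Data.Nat as ℕ using (ℕ; zero; suc; _∸_; _≤ᵇ_)
open import Data.Nat.DivMod using (_mod_)
open import Data.Fin as F using (Fin; toℕ; punchIn)
open import Data.Fin.Properties using () renaming (_≟_ to _≟ᶠ_)
open import Data.Fin.Subset using (Subset; _∈_)
open import Data.Bool using (Bool; true; false; if_then_else_)
open import Data.List as L using (List; []; _∷_)
open import Data.Vec using (lookup)
open import Data.Product using (Σ)
open import Relation.Nullary using (does)

-- Compartments are Fin n (compartment 1,…,n of the paper = 0,…,n-1 here).
-- Index arithmetic mod n.

next : ∀ {n} → Fin n → Fin n
next {suc m} i = suc (toℕ i) mod suc m

prev : ∀ {n} → Fin n → Fin n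
prev {suc m} i = (toℕ i ℕ.+ m) mod suc m

iter : ∀ {n} → ℕ → Fin n → Fin n
iter zero i = i
iter (suc t) i = iter t (next i)

steps : ∀ {n} → Fin n → Fin n → ℕ
steps {n} i j =
  if toℕ i ≤ᵇ toℕ j then toℕ j ∸ toℕ i else (n ℕ.+ toℕ j) ∸ toℕ i

-- Linear compartmental models (G, In, Out, Leak) on vertex set Fin n.
-- Edge j i = true  iff  j → i ∈ E.

record Model (n : ℕ) : Set where
  field
    Edge : Fin n → Fin n → Bool
    In   : Subset n
    Out  : Subset n
    Leak : Subset n

cycleModel : ∀ {n} → (In Out Leak : Subset n) → Model n
cycleModel In Out Leak = record
  { Edge = λ j i → does (i ≟ᶠ next j)
  ; In = In ; Out = Out ; Leak = Leak }

-- Indices of the entries of the coefficient map: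
--   yCoeff o d    : coefficient of y_o^(d)  (d < n; the leading coefficient
--                   of y_o^(n), which is 1, is not included)
--   uCoeff o j d  : coefficient of u_j^(d) in the equation for y_o
data CoeffIndex {n : ℕ} (M : Model n) : Set where
  yCoeff : (o : Fin n) → o ∈ Model.Out M → (d : Fin n) → CoeffIndex M
  uCoeff : (o : Fin n) → o ∈ Model.Out M → (j : Fin n) → j ∈ Model.In M →
           (d : Fin n) → CoeffIndex M

minor : ∀ {a} {A : Set a} {n} → (Fin n → Fin n → A) → Fin n → Fin n →
        Fin (ℕ.pred n) → Fin (ℕ.pred n) → A
minor {n = suc m} B r c i j = B (punchIn r i) (punchIn c j)

module Alg (R : CommutativeRing 0ℓ 0ℓ) where
  open CommutativeRing R hiding (zero)

  sumR : ∀ {n} → (Fin n → Carrier) → Carrier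
  sumR {zero} f = 0#
  sumR {suc n} f = f F.zero + sumR (f ∘ F.suc)

  prodR : ∀ {n} → (Fin n → Carrier) → Carrier
  prodR {zero} f = 1#
  prodR {suc n} f = f F.zero * prodR (f ∘ F.suc)

  sumℕ : ℕ → (ℕ → Carrier) → Carrier
  sumℕ zero f = 0#
  sumℕ (suc N) f = f zero + sumℕ N (f ∘ suc)

  prodℕ : ℕ → (ℕ → Carrier) → Carrier
  prodℕ zero f = 1#
  prodℕ (suc N) f = f zero * prodℕ N (f ∘ suc)

  esym : ℕ → List Carrier → Carrier
  esym zero _ = 1#
  esym (suc d) [] = 0#
  esym (suc d) (x ∷ xs) = x * esym d xs + esym (suc d) xs

  -- univariate polynomials in ∂ over R, as coefficient lists (lowest first)
  Pol : Set
  Pol = List Carrier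

  _⊕_ : Pol → Pol → Pol
  [] ⊕ q = q
  (a ∷ p) ⊕ [] = a ∷ p
  (a ∷ p) ⊕ (b ∷ q) = (a + b) ∷ (p ⊕ q)

  scaleP : Carrier → Pol → Pol
  scaleP a = L.map (a *_)

  _⊗_ : Pol → Pol → Pol
  [] ⊗ q = []
  (a ∷ p) ⊗ q = scaleP a q ⊕ (0# ∷ (p ⊗ q))

  ⊖_ : Pol → Pol
  ⊖ p = L.map (λ a → - a) p

  constP : Carrier → Pol
  constP a = a ∷ []

  ∂P : Pol
  ∂P = 0# ∷ 1# ∷ []

  coeff : Pol → ℕ → Carrier
  coeff [] _ = 0#
  coeff (a ∷ p) zero = a
  coeff (a ∷ p) (suc d) = coeff p d

  signP : ℕ → Pol → Pol
  signP zero p = p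
  signP (suc zero) p = ⊖ p
  signP (suc (suc e)) p = signP e p

  sumP : ∀ {n} → (Fin n → Pol) → Pol
  sumP {zero} f = []
  sumP {suc n} f = f F.zero ⊕ sumP (f ∘ F.suc)

  det : ∀ {n} → (Fin n → Fin n → Pol) → Pol
  det {zero} B = constP 1#
  det {suc n} B =
    sumP (λ j → signP (toℕ j) (B F.zero j ⊗ det (λ r c → B (F.suc r) (punchIn j c))))

  -- parameters: k i j = k_{ij} (used only for edges j → i), k0 ℓ = k_{0ℓ}
  Params : ℕ → Set
  Params n = Fin n → Fin n → Carrier

  leakTerm : ∀ {n} → Subset n → (Fin n → Carrier) → Fin n → Carrier
  leakTerm Leak k0 i = if lookup Leak i then k0 i else 0#

  compMatrix : ∀ {n} → Model n → Params n → (Fin n → Carrier) → Fin n → Fin n → Carrier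
  compMatrix M k k0 i j with does (i ≟ᶠ j)
  ... | true  = - (sumR (λ p → if Model.Edge M i p then k p i else 0#))
                + - (leakTerm (Model.Leak M) k0 i)
  ... | false = if Model.Edge M j i then k i j else 0#

  charMatrix : ∀ {n} → Model n → Params n → (Fin n → Carrier) → Fin n → Fin n → Pol
  charMatrix M k k0 i j =
    (if does (i ≟ᶠ j) then ∂P else []) ⊕ constP (- compMatrix M k k0 i j)

  -- the coefficient map: coefficient of y_o^(d) in det(∂I-A) y_o, and of
  -- u_j^(d) in (-1)^(o+j) det[(∂I-A)^{j,o}] u_j
  coeffMap : ∀ {n} (M : Model n) → Params n → (Fin n → Carrier) → CoeffIndex M → Carrier
  coeffMap M k k0 (yCoeff o _ d) = coeff (det (charMatrix M k k0)) (toℕ d)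
  coeffMap M k k0 (uCoeff o _ j _ d) =
    coeff (signP (toℕ j ℕ.+ toℕ o) (det (minor (charMatrix M k k0) j o))) (toℕ d)

  kc : ∀ {n} → Params n → Fin n → Carrier
  kc k i = k (next i) i

  eElt : ∀ {n} → Subset n → Params n → (Fin n → Carrier) → Fin n → Carrier
  eElt Leak k k0 i = kc k i + leakTerm Leak k0 i

  Eset : ∀ {n} → Subset n → Params n → (Fin n → Carrier) → List Carrier
  Eset Leak k k0 = L.tabulate (eElt Leak k k0)

  κ : ∀ {n} → Params n → Fin n → Fin n → Carrier
  κ k i j = prodℕ (steps i j) (λ t → kc k (iter t i))

  e1* : ∀ {n} → Subset n → Params n → (Fin n → Carrier) → Fin n → Fin n → Carrier
  e1* Leak k k0 i j = sumℕ (steps (next j) i) (λ t → eElt Leak k k0 (iter t (next j)))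

-- "the coefficient map of M contains the coefficient f": some fixed entry of
-- the coefficient map equals f as a polynomial in the parameters, i.e. for
-- every commutative ring R and every value of the parameters in R.

CoeffFun : ℕ → Set₁
CoeffFun n = (R : CommutativeRing 0ℓ 0ℓ) →
  (Fin n → Fin n → CommutativeRing.Carrier R) →
  (Fin n → CommutativeRing.Carrier R) → CommutativeRing.Carrier R

Contains : ∀ {n} → Model n → CoeffFun n → Set₁
Contains {n} M f = Σ (CoeffIndex M) λ idx →
  (R : CommutativeRing 0ℓ 0ℓ) →
  (k : Fin n → Fin n → CommutativeRing.Carrier R) →
  (k0 : Fin n → CommutativeRing.Carrier R) →
  CommutativeRing._≈_ R (Alg.coeffMap R M k k0 idx) (f R k k0)

{-# OPTIONS --safe #-}
module Submission where

-- For the directed cycle, ∂I − A has the diagonal entries ∂ + e_q (e_q = k_{q+1,q}, plus k_{0q} if q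
-- leaks), the entries −k_{q+1,q} just below the diagonal, the corner entry −k_{1n}, and zeros elsewhere.
-- Expanding along the first row, only the columns 1 and n contribute and both minors are bidiagonal,
-- so det(∂I − A) = ∏ (∂ + e_q) − ∏ k_{q+1,q}: its coefficients are the elementary symmetric
-- polynomials of E, and e_n(E) − ∏ k_{q+1,q} in degree 0.  Deleting row i and column j leaves a
-- matrix that becomes bidiagonal after at most one more first-row expansion; its diagonal consists
-- of the constants −k_{q+1,q} along the path i → j and the factors ∂ + e_q of the compartments
-- q = j+1, …, i−1 off that path.  The signs cancel, so the two top coefficients of the signed minor
-- are κ(i,j) and e₁*(i,j) κ(i,j).

open import Defs
open import Algebra.Bundles using (CommutativeRing)
open import Data.Nat using (ℕ; _≤_; _<_)
open import Data.Fin using (Fin)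
open import Data.Fin.Subset using (Subset; _∈_; Nonempty)
open import Data.Product using (_×_; _,_; proj₁; proj₂)
open import Relation.Binary.PropositionalEquality using (_≢_)

open import Level using (0ℓ)
open import Function using (_∘_)
open import Data.Nat as ℕ using (zero; suc; _∸_; z≤n; s≤s)
import Data.Nat.Properties as ℕ
open import Data.Nat.Tactic.RingSolver using (solve-∀)
open import Data.Nat.DivMod using (_mod_; _%_; m<n⇒m%n≡m; n%n≡0; m%n%n≡m%n; [m+n]%n≡m%n; %-distribˡ-+)
open import Data.Fin as F using (toℕ; punchIn)
import Data.Fin.Properties as F
open import Data.List as L using (List; []; _∷_)
open import Data.List.Properties using (tabulate-cong)
open import Data.Bool using (Bool; true; false; if_then_else_)
open import Data.Sum using (_⊎_; inj₁; inj₂)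
open import Data.Empty using (⊥-elim)
open import Relation.Nullary using (¬_; yes; no; does)
open import Relation.Nullary.Decidable using (dec-true; dec-false)
open import Relation.Binary.Core using (_Preserves_⟶_)
open import Relation.Binary.PropositionalEquality as ≡ using (_≡_)

module RingArithmetic (R : CommutativeRing 0ℓ 0ℓ) where
  open CommutativeRing R hiding (zero)
  open Alg R
  open import Algebra.Properties.Ring ring using (-0#≈0#; -‿distribˡ-*; -‿involutive)
  open import Relation.Binary.Reasoning.Setoid setoid

  if-true : ∀ {b} {x y : Carrier} → b ≡ true → (if b then x else y) ≈ x
  if-true ≡.refl = refl

  if-false : ∀ {b} {x y : Carrier} → b ≡ false → (if b then x else y) ≈ y
  if-false ≡.refl = refl

  sumℕ-cong : ∀ N {f g} → (∀ t → t < N → f t ≈ g t) → sumℕ N f ≈ sumℕ N g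
  sumℕ-cong zero    f≈g = refl
  sumℕ-cong (suc N) f≈g =
    +-cong (f≈g 0 (s≤s z≤n)) (sumℕ-cong N (λ t t<N → f≈g (suc t) (s≤s t<N)))

  prodℕ-cong : ∀ N {f g} → (∀ t → t < N → f t ≈ g t) → prodℕ N f ≈ prodℕ N g
  prodℕ-cong zero    f≈g = refl
  prodℕ-cong (suc N) f≈g =
    *-cong (f≈g 0 (s≤s z≤n)) (prodℕ-cong N (λ t t<N → f≈g (suc t) (s≤s t<N)))

  sumℕ-zero : ∀ N {f} → (∀ t → t < N → f t ≈ 0#) → sumℕ N f ≈ 0#
  sumℕ-zero zero    f≈0 = refl
  sumℕ-zero (suc N) f≈0 =
    trans (+-cong (f≈0 0 (s≤s z≤n)) (sumℕ-zero N (λ t t<N → f≈0 (suc t) (s≤s t<N)))) (+-identityˡ 0#)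

  prodℕ-one : ∀ N {f} → (∀ t → t < N → f t ≈ 1#) → prodℕ N f ≈ 1#
  prodℕ-one zero    f≈1 = refl
  prodℕ-one (suc N) f≈1 =
    trans (*-cong (f≈1 0 (s≤s z≤n)) (prodℕ-one N (λ t t<N → f≈1 (suc t) (s≤s t<N)))) (*-identityˡ 1#)

  sumℕ-+ : ∀ p q f → sumℕ (p ℕ.+ q) f ≈ sumℕ p f + sumℕ q (λ t → f (p ℕ.+ t))
  sumℕ-+ zero    q f = sym (+-identityˡ _)
  sumℕ-+ (suc p) q f = trans (+-cong refl (sumℕ-+ p q (f ∘ suc))) (sym (+-assoc _ _ _))

  prodℕ-+ : ∀ p q f → prodℕ (p ℕ.+ q) f ≈ prodℕ p f * prodℕ q (λ t → f (p ℕ.+ t))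
  prodℕ-+ zero    q f = sym (*-identityˡ _)
  prodℕ-+ (suc p) q f = trans (*-cong refl (prodℕ-+ p q (f ∘ suc))) (sym (*-assoc _ _ _))

  prodℕ-suc : ∀ N f → prodℕ (suc N) f ≈ prodℕ N f * f N
  prodℕ-suc N f = begin
    prodℕ (suc N) f                 ≡⟨ ≡.cong (λ M → prodℕ M f) (ℕ.+-comm 1 N) ⟩
    prodℕ (N ℕ.+ 1) f               ≈⟨ prodℕ-+ N 1 f ⟩
    prodℕ N f * (f (N ℕ.+ 0) * 1#)  ≈⟨ *-cong refl (*-identityʳ _) ⟩
    prodℕ N f * f (N ℕ.+ 0)         ≡⟨ ≡.cong (λ t → prodℕ N f * f t) (ℕ.+-identityʳ N) ⟩
    prodℕ N f * f N                 ∎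

  prodR≈prodℕ : ∀ {N} (f : Fin N → Carrier) (g : ℕ → Carrier) →
                (∀ x → f x ≈ g (toℕ x)) → prodR f ≈ prodℕ N g
  prodR≈prodℕ {zero}  f g f≈g = refl
  prodR≈prodℕ {suc N} f g f≈g =
    *-cong (f≈g F.zero) (prodR≈prodℕ (f ∘ F.suc) (g ∘ suc) (f≈g ∘ F.suc))

  sumR-zero : ∀ {N} {f : Fin N → Carrier} → (∀ x → f x ≈ 0#) → sumR f ≈ 0#
  sumR-zero {zero}  f≈0 = refl
  sumR-zero {suc N} f≈0 = trans (+-cong (f≈0 F.zero) (sumR-zero (f≈0 ∘ F.suc))) (+-identityˡ 0#)

  sumR-single : ∀ {N} (f : Fin N → Carrier) x₀ → (∀ x → x ≢ x₀ → f x ≈ 0#) → sumR f ≈ f x₀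
  sumR-single f F.zero     f≈0 =
    trans (+-cong refl (sumR-zero (λ x → f≈0 (F.suc x) λ ()))) (+-identityʳ _)
  sumR-single f (F.suc x₀) f≈0 = trans (+-cong (f≈0 F.zero λ ()) refl) (trans (+-identityˡ _)
    (sumR-single (f ∘ F.suc) x₀ (λ x x≢x₀ → f≈0 (F.suc x) (x≢x₀ ∘ F.suc-injective))))

  sign : ℕ → Carrier → Carrier
  sign zero          x = x
  sign (suc zero)    x = - x
  sign (suc (suc e)) x = sign e x

  sign-cong : ∀ e {x y} → x ≈ y → sign e x ≈ sign e y
  sign-cong zero          x≈y = x≈y
  sign-cong (suc zero)    x≈y = -‿cong x≈y
  sign-cong (suc (suc e)) x≈y = sign-cong e x≈y

  sign-zero : ∀ e → sign e 0# ≈ 0#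
  sign-zero zero          = refl
  sign-zero (suc zero)    = -0#≈0#
  sign-zero (suc (suc e)) = sign-zero e

  sign-suc : ∀ e x → sign (suc e) x ≈ - sign e x
  sign-suc zero          x = refl
  sign-suc (suc zero)    x = sym (-‿involutive x)
  sign-suc (suc (suc e)) x = sign-suc e x

  sign-sign : ∀ p q x → sign p (sign q x) ≈ sign (p ℕ.+ q) x
  sign-sign zero          q x = refl
  sign-sign (suc zero)    q x = sym (sign-suc q x)
  sign-sign (suc (suc p)) q x = sign-sign p q x

  sign-even : ∀ e w x → e ≡ w ℕ.+ w → sign e x ≈ x
  sign-even _ zero    x ≡.refl = refl
  sign-even _ (suc w) x ≡.refl rewrite ℕ.+-suc w w = sign-even _ w x ≡.refl

  sign-odd : ∀ e w x → e ≡ suc (w ℕ.+ w) → sign e x ≈ - x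
  sign-odd _ w x ≡.refl = trans (sign-suc (w ℕ.+ w) x) (-‿cong (sign-even _ w x ≡.refl))

  sign-*ˡ : ∀ e x y → sign e x * y ≈ sign e (x * y)
  sign-*ˡ zero          x y = refl
  sign-*ˡ (suc zero)    x y = sym (-‿distribˡ-* x y)
  sign-*ˡ (suc (suc e)) x y = sign-*ˡ e x y

  sign-*ʳ : ∀ e x y → x * sign e y ≈ sign e (x * y)
  sign-*ʳ e x y = trans (*-comm _ _) (trans (sign-*ˡ e y x) (sign-cong e (*-comm _ _)))

  prodℕ-neg : ∀ N g → prodℕ N (λ t → - g t) ≈ sign N (prodℕ N g)
  prodℕ-neg zero    g = refl
  prodℕ-neg (suc N) g = begin
    - g 0 * prodℕ N (λ t → - g (suc t))   ≈⟨ *-cong refl (prodℕ-neg N (g ∘ suc)) ⟩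
    - g 0 * sign N (prodℕ N (g ∘ suc))    ≈⟨ -‿distribˡ-* _ _ ⟨
    - (g 0 * sign N (prodℕ N (g ∘ suc)))  ≈⟨ -‿cong (sign-*ʳ N _ _) ⟩
    - sign N (prodℕ (suc N) g)            ≈⟨ sign-suc N _ ⟨
    sign (suc N) (prodℕ (suc N) g)        ∎

module Polynomials (R : CommutativeRing 0ℓ 0ℓ) where
  open CommutativeRing R hiding (zero)
  open Alg R
  open RingArithmetic R
  open import Algebra.Properties.Ring ring using (-0#≈0#)
  open import Relation.Binary.Reasoning.Setoid setoid

  infix 4 _≋_
  record _≋_ (p q : Pol) : Set where
    constructor coeffwise
    field coeff-≈ : ∀ d → coeff p d ≈ coeff q d
  open _≋_ public

  ≋-refl : ∀ {p} → p ≋ p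
  ≋-refl = coeffwise λ _ → refl

  ≋-trans : ∀ {p q r} → p ≋ q → q ≋ r → p ≋ r
  ≋-trans p≋q q≋r = coeffwise λ d → trans (coeff-≈ p≋q d) (coeff-≈ q≋r d)

  coeff-⊕ : ∀ p q d → coeff (p ⊕ q) d ≈ coeff p d + coeff q d
  coeff-⊕ []      q       d       = sym (+-identityˡ _)
  coeff-⊕ (a ∷ p) []      d       = sym (+-identityʳ _)
  coeff-⊕ (a ∷ p) (b ∷ q) zero    = refl
  coeff-⊕ (a ∷ p) (b ∷ q) (suc d) = coeff-⊕ p q d

  coeff-scaleP : ∀ a q d → coeff (scaleP a q) d ≈ a * coeff q d
  coeff-scaleP a []      d       = sym (zeroʳ a)
  coeff-scaleP a (b ∷ q) zero    = refl
  coeff-scaleP a (b ∷ q) (suc d) = coeff-scaleP a q d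

  coeff-⊖ : ∀ p d → coeff (⊖ p) d ≈ - coeff p d
  coeff-⊖ []      d       = sym -0#≈0#
  coeff-⊖ (a ∷ p) zero    = refl
  coeff-⊖ (a ∷ p) (suc d) = coeff-⊖ p d

  coeff-signP : ∀ e p d → coeff (signP e p) d ≈ sign e (coeff p d)
  coeff-signP zero          p d = refl
  coeff-signP (suc zero)    p d = coeff-⊖ p d
  coeff-signP (suc (suc e)) p d = coeff-signP e p d

  coeff-sumP : ∀ {N} (f : Fin N → Pol) d → coeff (sumP f) d ≈ sumR (λ x → coeff (f x) d)
  coeff-sumP {zero}  f d = refl
  coeff-sumP {suc N} f d = trans (coeff-⊕ (f F.zero) _ d) (+-cong refl (coeff-sumP (f ∘ F.suc) d))

  convolution : Pol → Pol → ℕ → Carrier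
  convolution p q d = sumℕ (suc d) (λ i → coeff p i * coeff q (d ∸ i))

  coeff-⊗ : ∀ p q d → coeff (p ⊗ q) d ≈ convolution p q d
  coeff-⊗ []      q d       = sym (sumℕ-zero (suc d) {λ i → 0# * coeff q (d ∸ i)} (λ _ _ → zeroˡ _))
  coeff-⊗ (a ∷ p) q zero    = begin
    coeff (scaleP a q ⊕ (0# ∷ (p ⊗ q))) 0         ≈⟨ coeff-⊕ (scaleP a q) _ 0 ⟩
    coeff (scaleP a q) 0 + 0#                     ≈⟨ +-cong (coeff-scaleP a q 0) refl ⟩
    a * coeff q 0 + 0#                            ∎
  coeff-⊗ (a ∷ p) q (suc d) = begin
    coeff (scaleP a q ⊕ (0# ∷ (p ⊗ q))) (suc d)   ≈⟨ coeff-⊕ (scaleP a q) _ (suc d) ⟩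
    coeff (scaleP a q) (suc d) + coeff (p ⊗ q) d  ≈⟨ +-cong (coeff-scaleP a q (suc d)) (coeff-⊗ p q d) ⟩
    a * coeff q (suc d) + convolution p q d       ∎

  ⊕-cong : ∀ {p p′ q q′} → p ≋ p′ → q ≋ q′ → p ⊕ q ≋ p′ ⊕ q′
  ⊕-cong {p} {p′} {q} {q′} p≋p′ q≋q′ = coeffwise λ d → trans (coeff-⊕ p q d)
    (trans (+-cong (coeff-≈ p≋p′ d) (coeff-≈ q≋q′ d)) (sym (coeff-⊕ p′ q′ d)))

  ⊗-cong : ∀ {p p′ q q′} → p ≋ p′ → q ≋ q′ → p ⊗ q ≋ p′ ⊗ q′
  ⊗-cong {p} {p′} {q} {q′} p≋p′ q≋q′ = coeffwise λ d → begin
    coeff (p ⊗ q) d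
      ≈⟨ coeff-⊗ p q d ⟩
    convolution p q d
      ≈⟨ sumℕ-cong (suc d) (λ i _ → *-cong (coeff-≈ p≋p′ i) (coeff-≈ q≋q′ (d ∸ i))) ⟩
    convolution p′ q′ d
      ≈⟨ coeff-⊗ p′ q′ d ⟨
    coeff (p′ ⊗ q′) d ∎

  ⊗-zeroˡ : ∀ {p} q → p ≋ [] → p ⊗ q ≋ []
  ⊗-zeroˡ {p} q p≋0 = coeffwise λ d →
    trans (coeff-⊗ p q d) (sumℕ-zero (suc d) {λ i → coeff p i * coeff q (d ∸ i)}
      (λ i _ → trans (*-cong (coeff-≈ p≋0 i) refl) (zeroˡ _)))

  ⊗-zeroʳ : ∀ p {q} → q ≋ [] → p ⊗ q ≋ []
  ⊗-zeroʳ p {q} q≋0 = coeffwise λ d →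
    trans (coeff-⊗ p q d) (sumℕ-zero (suc d) {λ i → coeff p i * coeff q (d ∸ i)}
      (λ i _ → trans (*-cong refl (coeff-≈ q≋0 (d ∸ i))) (zeroʳ _)))

  signP-cong : ∀ e {p q} → p ≋ q → signP e p ≋ signP e q
  signP-cong e {p} {q} p≋q = coeffwise λ d →
    trans (coeff-signP e p d) (trans (sign-cong e (coeff-≈ p≋q d)) (sym (coeff-signP e q d)))

  signP-zero : ∀ e {p} → p ≋ [] → signP e p ≋ []
  signP-zero e {p} p≋0 = coeffwise λ d →
    trans (coeff-signP e p d) (trans (sign-cong e (coeff-≈ p≋0 d)) (sign-zero e))

  prodP : ∀ {N} → (Fin N → Pol) → Pol
  prodP {zero}  f = constP 1#
  prodP {suc N} f = f F.zero ⊗ prodP (f ∘ F.suc)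

  prodP-zero : ∀ {N} (f : Fin N → Pol) x → f x ≋ [] → prodP f ≋ []
  prodP-zero f F.zero    fx≋0 = ⊗-zeroˡ _ fx≋0
  prodP-zero f (F.suc x) fx≋0 = ⊗-zeroʳ (f F.zero) (prodP-zero (f ∘ F.suc) x fx≋0)

  coeff-constant-⊗ : ∀ {p c} q → p ≋ c ∷ [] → ∀ d → coeff (p ⊗ q) d ≈ c * coeff q d
  coeff-constant-⊗ {p} {c} q p≋c d = trans (coeff-≈ (⊗-cong p≋c (≋-refl {q})) d)
    (trans (coeff-⊗ (c ∷ []) q d) (trans (+-cong refl (sumℕ-zero d (λ _ _ → zeroˡ _))) (+-identityʳ _)))

  coeff-linear-⊗-zero : ∀ {p e} q → p ≋ e ∷ 1# ∷ [] → coeff (p ⊗ q) 0 ≈ e * coeff q 0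
  coeff-linear-⊗-zero {p} {e} q p≋∂+e =
    trans (coeff-≈ (⊗-cong p≋∂+e (≋-refl {q})) 0) (trans (coeff-⊗ (e ∷ 1# ∷ []) q 0) (+-identityʳ _))

  coeff-linear-⊗-suc : ∀ {p e} q → p ≋ e ∷ 1# ∷ [] → ∀ d →
    coeff (p ⊗ q) (suc d) ≈ e * coeff q (suc d) + coeff q d
  coeff-linear-⊗-suc {p} {e} q p≋∂+e d = trans (coeff-≈ (⊗-cong p≋∂+e (≋-refl {q})) (suc d))
    (trans (coeff-⊗ (e ∷ 1# ∷ []) q (suc d))
      (+-cong refl (trans (+-cong (*-identityˡ _) (sumℕ-zero d (λ _ _ → zeroˡ _))) (+-identityʳ _))))

module Determinants (R : CommutativeRing 0ℓ 0ℓ) where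
  open CommutativeRing R hiding (zero)
  open Alg R
  open RingArithmetic R
  open Polynomials R

  Matrix : ℕ → Set
  Matrix N = Fin N → Fin N → Pol

  cofactorTerm : ∀ {N} → Matrix (suc N) → Fin (suc N) → Pol
  cofactorTerm B j = signP (toℕ j) (B F.zero j ⊗ det (minor B F.zero j))

  TermVanishes : ∀ {N} → Matrix (suc N) → Fin (suc N) → Set
  TermVanishes B j = B F.zero j ≋ [] ⊎ det (minor B F.zero j) ≋ []

  cofactorTerm-zero : ∀ {N} (B : Matrix (suc N)) j → TermVanishes B j → cofactorTerm B j ≋ []
  cofactorTerm-zero B j (inj₁ entry≋0) = signP-zero (toℕ j) (⊗-zeroˡ _ entry≋0)
  cofactorTerm-zero B j (inj₂ det≋0)   = signP-zero (toℕ j) (⊗-zeroʳ (B F.zero j) det≋0)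

  det-single-term : ∀ {N} (B : Matrix (suc N)) j₀ →
    (∀ j → j ≢ j₀ → TermVanishes B j) → det B ≋ cofactorTerm B j₀
  det-single-term B j₀ vanish = coeffwise λ d → trans (coeff-sumP (cofactorTerm B) d)
    (sumR-single _ j₀ (λ j j≢j₀ → coeff-≈ (cofactorTerm-zero B j (vanish j j≢j₀)) d))

  det-first-and-last-term : ∀ {N} (B : Matrix (suc (suc N))) →
    (∀ j → j ≢ F.zero → j ≢ F.fromℕ (suc N) → B F.zero j ≋ []) →
    det B ≋ cofactorTerm B F.zero ⊕ cofactorTerm B (F.fromℕ (suc N))
  det-first-and-last-term B entry≋0 = coeffwise λ d → trans (coeff-sumP (cofactorTerm B) d)
    (trans (+-cong refl (sumR-single _ (F.fromℕ _) λ j j≢last → coeff-≈ (cofactorTerm-zero B (F.suc j)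
                          (inj₁ (entry≋0 (F.suc j) (λ ()) (j≢last ∘ F.suc-injective)))) d))
           (sym (coeff-⊕ (cofactorTerm B F.zero) _ d)))

  mutual
    det-zero-column : ∀ {N} (B : Matrix N) c → (∀ r → B r c ≋ []) → det B ≋ []
    det-zero-column {suc N} B c column≋0 = coeffwise λ d → trans (coeff-sumP (cofactorTerm B) d)
      (sumR-zero λ j → coeff-≈ (cofactorTerm-zero B j (vanish j)) d)
      where
      vanish : ∀ j → TermVanishes B j
      vanish j with j F.≟ c
      ... | yes ≡.refl = inj₁ (column≋0 F.zero)
      ... | no j≢c     = inj₂ (minor-zero-column {N} B j≢c (column≋0 ∘ F.suc))

    minor-zero-column : ∀ {N} (B : Matrix (suc N)) {j c} → j ≢ c →
      (∀ r → B (F.suc r) c ≋ []) → det (minor B F.zero j) ≋ []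
    minor-zero-column {N} B {j} j≢c column≋0 =
      det-zero-column {N} (minor B F.zero j) (F.punchOut j≢c) λ r →
        ≡.subst (λ c′ → B (F.suc r) c′ ≋ []) (≡.sym (F.punchIn-punchOut j≢c)) (column≋0 r)

  -- Only the diagonal term of the first-row expansion survives: for j > 0 either B 0 j vanishes,
  -- or γ 0 < γ j ≤ ρ 0 and then the first column of the minor vanishes.
  det-bidiagonal : ∀ {N} (B : Matrix N) (ρ γ : Fin N → ℕ) →
    ρ Preserves F._<_ ⟶ ℕ._<_ → γ Preserves F._<_ ⟶ ℕ._<_ →
    (∀ x y → ρ x < γ y → B x y ≋ []) → (∀ x y → suc (γ y) < ρ x → B x y ≋ []) →
    det B ≋ prodP (λ x → B x x)
  det-bidiagonal {zero}  B ρ γ ρ↑ γ↑ above below = ≋-refl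
  det-bidiagonal {suc N} B ρ γ ρ↑ γ↑ above below = ≋-trans (det-single-term B F.zero vanish)
    (⊗-cong (≋-refl {B F.zero F.zero})
      (det-bidiagonal {N} (minor B F.zero F.zero) (ρ ∘ F.suc) (γ ∘ F.suc) (ρ↑ ∘ s≤s) (γ↑ ∘ s≤s)
                      (λ x y → above (F.suc x) (F.suc y)) (λ x y → below (F.suc x) (F.suc y))))
    where
    vanish : ∀ j → j ≢ F.zero → TermVanishes B j
    vanish F.zero     0≢0 = ⊥-elim (0≢0 ≡.refl)
    vanish (F.suc j) _ with ρ F.zero ℕ.<? γ (F.suc j)
    ... | yes ρ₀<γⱼ = inj₁ (above F.zero (F.suc j) ρ₀<γⱼ)
    ... | no  ρ₀≮γⱼ = inj₂ (minor-zero-column B {c = F.zero} (λ ()) λ r → below (F.suc r) F.zero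
          (ℕ.≤-<-trans (ℕ.≤-trans (γ↑ {F.zero} {F.suc j} (s≤s z≤n)) (ℕ.≮⇒≥ ρ₀≮γⱼ))
                       (ρ↑ {F.zero} {F.suc r} (s≤s z≤n))))

module FactorProducts (R : CommutativeRing 0ℓ 0ℓ) where
  open CommutativeRing R hiding (zero)
  open Alg R
  open RingArithmetic R
  open Polynomials R
  open import Relation.Binary.Reasoning.Setoid setoid
  open import Algebra.Solver.Ring.NaturalCoefficients.Default commutativeSemiring

  factor : Bool → Carrier → Carrier → Pol
  factor true  e c = e ∷ 1# ∷ []
  factor false e c = c ∷ []

  -- Indexing b, e and c by ℕ rather than Fin M lets runs of consecutive factors be split off by shifting.
  record Factors {M} (f : Fin M → Pol) (b : ℕ → Bool) (e c : ℕ → Carrier) : Set where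
    constructor factors
    field factor-≋ : ∀ x → f x ≋ factor (b (toℕ x)) (e (toℕ x)) (c (toℕ x))
  open Factors

  Factors-tail : ∀ {M} {f : Fin (suc M) → Pol} {b e c} → Factors f b e c →
                 Factors (f ∘ F.suc) (b ∘ suc) (e ∘ suc) (c ∘ suc)
  Factors-tail fs = factors (factor-≋ fs ∘ F.suc)

  #linear : ℕ → (ℕ → Bool) → ℕ
  #linear zero    b = 0
  #linear (suc M) b = if b 0 then suc (#linear M (b ∘ suc)) else #linear M (b ∘ suc)

  linearTerms : ℕ → (ℕ → Bool) → (ℕ → Carrier) → List Carrier
  linearTerms zero    b e = []
  linearTerms (suc M) b e =
    if b 0 then e 0 ∷ linearTerms M (b ∘ suc) (e ∘ suc) else linearTerms M (b ∘ suc) (e ∘ suc)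

  constantPart : ℕ → (ℕ → Bool) → (ℕ → Carrier) → Carrier
  constantPart M b c = prodℕ M (λ t → if b t then 1# else c t)

  linearSum : ℕ → (ℕ → Bool) → (ℕ → Carrier) → Carrier
  linearSum M b e = sumℕ M (λ t → if b t then e t else 0#)

  esym-linearTerms-above : ∀ M b e d → #linear M b < d → esym d (linearTerms M b e) ≈ 0#
  esym-linearTerms-above zero    b e (suc d) _ = refl
  esym-linearTerms-above (suc M) b e d K<d with b 0
  esym-linearTerms-above (suc M) b e (suc d) (s≤s K<d) | true =
    trans (+-cong (*-cong refl (esym-linearTerms-above M (b ∘ suc) (e ∘ suc) d K<d))
                  (esym-linearTerms-above M (b ∘ suc) (e ∘ suc) (suc d) (ℕ.m<n⇒m<1+n K<d)))
          (trans (+-identityʳ _) (zeroʳ _))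
  ... | false = esym-linearTerms-above M (b ∘ suc) (e ∘ suc) d K<d

  esym-one-linearTerms : ∀ M b e → esym 1 (linearTerms M b e) ≈ linearSum M b e
  esym-one-linearTerms zero    b e = refl
  esym-one-linearTerms (suc M) b e with b 0
  ... | true  = +-cong (*-identityʳ _) (esym-one-linearTerms M (b ∘ suc) (e ∘ suc))
  ... | false = trans (esym-one-linearTerms M (b ∘ suc) (e ∘ suc)) (sym (+-identityˡ _))

  coeff-prodP-above : ∀ {M} {f : Fin M → Pol} {b e c} → Factors f b e c →
    ∀ s → #linear M b < s → coeff (prodP f) s ≈ 0#
  coeff-prodP-above {zero} fs (suc s) _ = refl
  coeff-prodP-above {suc M} {f} {b} fs s K<s with b 0 | factor-≋ fs F.zero
  coeff-prodP-above {suc M} {f} {b} {e} fs (suc s) (s≤s K<s) | true | f₀≋ = begin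
    coeff (f F.zero ⊗ P) (suc s)
      ≈⟨ coeff-linear-⊗-suc P f₀≋ s ⟩
    e 0 * coeff P (suc s) + coeff P s
      ≈⟨ +-cong (*-cong refl (coeff-prodP-above (Factors-tail fs) (suc s) (ℕ.m<n⇒m<1+n K<s)))
                (coeff-prodP-above (Factors-tail fs) s K<s) ⟩
    e 0 * 0# + 0#
      ≈⟨ trans (+-identityʳ _) (zeroʳ _) ⟩
    0# ∎
    where
    P : Pol
    P = prodP (f ∘ F.suc)
  ... | false | f₀≋ = trans (coeff-constant-⊗ (prodP (f ∘ F.suc)) f₀≋ s)
    (trans (*-cong refl (coeff-prodP-above (Factors-tail fs) s K<s)) (zeroʳ _))

  coeff-prodP : ∀ {M} {f : Fin M → Pol} {b e c} → Factors f b e c →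
    ∀ s d → s ℕ.+ d ≡ #linear M b →
    coeff (prodP f) s ≈ constantPart M b c * esym d (linearTerms M b e)
  coeff-prodP {zero} fs zero zero _ = sym (*-identityˡ 1#)
  coeff-prodP {suc M} {f} {b} {e} {c} fs s d s+d≡ with b 0 | factor-≋ fs F.zero
  ... | false | f₀≋ = begin
    coeff (f F.zero ⊗ P) s                   ≈⟨ coeff-constant-⊗ P f₀≋ s ⟩
    c 0 * coeff P s                          ≈⟨ *-cong refl (coeff-prodP (Factors-tail fs) s d s+d≡) ⟩
    c 0 * (C′ * esym d L′)                   ≈⟨ *-assoc _ _ _ ⟨
    c 0 * C′ * esym d L′                     ∎
    where
    P : Pol
    P = prodP (f ∘ F.suc)
    C′ : Carrier
    C′ = constantPart M (b ∘ suc) (c ∘ suc)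
    L′ : List Carrier
    L′ = linearTerms M (b ∘ suc) (e ∘ suc)
  coeff-prodP {suc M} {f} {b} {e} {c} fs zero (suc d) ≡.refl | true | f₀≋ = begin
    coeff (f F.zero ⊗ P) 0
      ≈⟨ coeff-linear-⊗-zero P f₀≋ ⟩
    e 0 * coeff P 0
      ≈⟨ *-cong refl (coeff-prodP (Factors-tail fs) 0 d ≡.refl) ⟩
    e 0 * (C′ * esym d L′)
      ≈⟨ solve 3 (λ x y z → x :* (y :* z) := con 1 :* y :* (x :* z :+ con 0))
                refl (e 0) C′ (esym d L′) ⟩
    1# * C′ * (e 0 * esym d L′ + 0#)
      ≈⟨ *-cong refl (+-cong refl (esym-linearTerms-above M (b ∘ suc) (e ∘ suc)
                                     (suc d) (ℕ.n<1+n d))) ⟨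
    1# * C′ * (e 0 * esym d L′ + esym (suc d) L′) ∎
    where
    P : Pol
    P = prodP (f ∘ F.suc)
    C′ : Carrier
    C′ = constantPart M (b ∘ suc) (c ∘ suc)
    L′ : List Carrier
    L′ = linearTerms M (b ∘ suc) (e ∘ suc)
  coeff-prodP {suc M} {f} {b} {e} {c} fs (suc s) zero s+0≡ | true | f₀≋ = begin
    coeff (f F.zero ⊗ P) (suc s)
      ≈⟨ coeff-linear-⊗-suc P f₀≋ s ⟩
    e 0 * coeff P (suc s) + coeff P s
      ≈⟨ +-cong (*-cong refl (coeff-prodP-above (Factors-tail fs) (suc s) K<1+s))
                (coeff-prodP (Factors-tail fs) s 0 (ℕ.suc-injective s+0≡)) ⟩
    e 0 * 0# + C′ * 1#
      ≈⟨ solve 2 (λ x y → x :* con 0 :+ y :* con 1 := con 1 :* y :* con 1) refl (e 0) C′ ⟩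
    1# * C′ * 1# ∎
    where
    P : Pol
    P = prodP (f ∘ F.suc)
    C′ : Carrier
    C′ = constantPart M (b ∘ suc) (c ∘ suc)
    K<1+s : #linear M (b ∘ suc) < suc s
    K<1+s = s≤s (ℕ.≤-reflexive (≡.trans (≡.sym (ℕ.suc-injective s+0≡)) (ℕ.+-identityʳ s)))
  coeff-prodP {suc M} {f} {b} {e} {c} fs (suc s) (suc d) s+d≡ | true | f₀≋ = begin
    coeff (f F.zero ⊗ P) (suc s)
      ≈⟨ coeff-linear-⊗-suc P f₀≋ s ⟩
    e 0 * coeff P (suc s) + coeff P s
      ≈⟨ +-cong (*-cong refl (coeff-prodP (Factors-tail fs) (suc s) d
                 (≡.trans (≡.sym (ℕ.+-suc s d)) (ℕ.suc-injective s+d≡))))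
                (coeff-prodP (Factors-tail fs) s (suc d) (ℕ.suc-injective s+d≡)) ⟩
    e 0 * (C′ * esym d L′) + C′ * esym (suc d) L′
      ≈⟨ solve 4 (λ x y z w → x :* (y :* z) :+ y :* w := con 1 :* y :* (x :* z :+ w))
               refl (e 0) C′ (esym d L′) (esym (suc d) L′) ⟩
    1# * C′ * (e 0 * esym d L′ + esym (suc d) L′) ∎
    where
    P : Pol
    P = prodP (f ∘ F.suc)
    C′ : Carrier
    C′ = constantPart M (b ∘ suc) (c ∘ suc)
    L′ : List Carrier
    L′ = linearTerms M (b ∘ suc) (e ∘ suc)

  coeff-prodP-leading : ∀ {M} {f : Fin M → Pol} {b e c} → Factors f b e c →
    coeff (prodP f) (#linear M b) ≈ constantPart M b c
  coeff-prodP-leading fs = trans (coeff-prodP fs _ 0 (ℕ.+-identityʳ _)) (*-identityʳ _)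

  coeff-prodP-subleading : ∀ {M} {f : Fin M → Pol} {b e c} → Factors f b e c →
    ∀ s → suc s ≡ #linear M b → coeff (prodP f) s ≈ constantPart M b c * linearSum M b e
  coeff-prodP-subleading {M} {b = b} {e} fs s 1+s≡ =
    trans (coeff-prodP fs s 1 (≡.trans (ℕ.+-comm s 1) 1+s≡)) (*-cong refl (esym-one-linearTerms M b e))

  ConstantOn : ℕ → (ℕ → Bool) → Bool → Set
  ConstantOn L b v = ∀ t → t < L → b t ≡ v

  ConstantOn-tail : ∀ {L b v} → ConstantOn (suc L) b v → ConstantOn L (b ∘ suc) v
  ConstantOn-tail const t t<L = const (suc t) (s≤s t<L)

  #linear-+ : ∀ p q b → #linear (p ℕ.+ q) b ≡ #linear p b ℕ.+ #linear q (b ∘ (p ℕ.+_))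
  #linear-+ zero    q b = ≡.refl
  #linear-+ (suc p) q b with b 0
  ... | true  = ≡.cong suc (#linear-+ p q (b ∘ suc))
  ... | false = #linear-+ p q (b ∘ suc)

  #linear-true : ∀ L b → ConstantOn L b true → #linear L b ≡ L
  #linear-true zero    b _     = ≡.refl
  #linear-true (suc L) b const rewrite const 0 (s≤s z≤n) =
    ≡.cong suc (#linear-true L (b ∘ suc) (ConstantOn-tail const))

  #linear-false : ∀ L b → ConstantOn L b false → #linear L b ≡ 0
  #linear-false zero    b _     = ≡.refl
  #linear-false (suc L) b const rewrite const 0 (s≤s z≤n) = #linear-false L (b ∘ suc) (ConstantOn-tail const)

  constantPart-true : ∀ L b c → ConstantOn L b true → constantPart L b c ≈ 1#
  constantPart-true L b c const = prodℕ-one L (λ t t<L → if-true (const t t<L))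

  constantPart-false : ∀ L b c → ConstantOn L b false → constantPart L b c ≈ prodℕ L c
  constantPart-false L b c const = prodℕ-cong L (λ t t<L → if-false (const t t<L))

  linearSum-true : ∀ L b e → ConstantOn L b true → linearSum L b e ≈ sumℕ L e
  linearSum-true L b e const = sumℕ-cong L (λ t t<L → if-true (const t t<L))

  linearSum-false : ∀ L b e → ConstantOn L b false → linearSum L b e ≈ 0#
  linearSum-false L b e const = sumℕ-zero L (λ t t<L → if-false (const t t<L))

  linearTerms-true : ∀ M e → linearTerms M (λ _ → true) e ≡ L.tabulate (λ (x : Fin M) → e (toℕ x))
  linearTerms-true zero    e = ≡.refl
  linearTerms-true (suc M) e = ≡.cong (e 0 ∷_) (linearTerms-true M (e ∘ suc))

  true-false-true-blocks : ∀ {M} p q r b e c → p ℕ.+ (q ℕ.+ r) ≡ M →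
    ConstantOn p b true → ConstantOn q (b ∘ (p ℕ.+_)) false →
    ConstantOn r (b ∘ (p ℕ.+_) ∘ (q ℕ.+_)) true →
    #linear M b ≡ p ℕ.+ r
    × constantPart M b c ≈ prodℕ q (c ∘ (p ℕ.+_))
    × linearSum M b e ≈ sumℕ p e + sumℕ r (e ∘ (p ℕ.+_) ∘ (q ℕ.+_))
  true-false-true-blocks p q r b e c ≡.refl first middle last =
      ≡.trans (#linear-+ p (q ℕ.+ r) b)
        (≡.cong₂ ℕ._+_ (#linear-true p b first)
                       (≡.trans (#linear-+ q r b′)
                                (≡.cong₂ ℕ._+_ (#linear-false q b′ middle) (#linear-true r b″ last))))
    , (begin
        constantPart (p ℕ.+ (q ℕ.+ r)) b c
          ≈⟨ prodℕ-+ p (q ℕ.+ r) _ ⟩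
        constantPart p b c * constantPart (q ℕ.+ r) b′ c′
          ≈⟨ *-cong (constantPart-true p b c first) (prodℕ-+ q r _) ⟩
        1# * (constantPart q b′ c′ * constantPart r b″ c″)
          ≈⟨ *-cong refl (*-cong (constantPart-false q b′ c′ middle)
                                 (constantPart-true r b″ c″ last)) ⟩
        1# * (prodℕ q c′ * 1#)
          ≈⟨ trans (*-identityˡ _) (*-identityʳ _) ⟩
        prodℕ q c′ ∎)
    , (begin
        linearSum (p ℕ.+ (q ℕ.+ r)) b e
          ≈⟨ sumℕ-+ p (q ℕ.+ r) _ ⟩
        linearSum p b e + linearSum (q ℕ.+ r) b′ e′
          ≈⟨ +-cong (linearSum-true p b e first) (sumℕ-+ q r _) ⟩
        sumℕ p e + (linearSum q b′ e′ + linearSum r b″ e″)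
          ≈⟨ +-cong refl (+-cong (linearSum-false q b′ e′ middle)
                                 (linearSum-true r b″ e″ last)) ⟩
        sumℕ p e + (0# + sumℕ r e″)
          ≈⟨ +-cong refl (+-identityˡ _) ⟩
        sumℕ p e + sumℕ r e″ ∎)
    where
    b′ b″ : ℕ → Bool
    b′ = b ∘ (p ℕ.+_)
    b″ = b′ ∘ (q ℕ.+_)
    c′ c″ e′ e″ : ℕ → Carrier
    c′ = c ∘ (p ℕ.+_)
    c″ = c′ ∘ (q ℕ.+_)
    e′ = e ∘ (p ℕ.+_)
    e″ = e′ ∘ (q ℕ.+_)

  false-true-false-blocks : ∀ {M} p q r b e c → p ℕ.+ (q ℕ.+ r) ≡ M →
    ConstantOn p b false → ConstantOn q (b ∘ (p ℕ.+_)) true →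
    ConstantOn r (b ∘ (p ℕ.+_) ∘ (q ℕ.+_)) false →
    #linear M b ≡ q
    × constantPart M b c ≈ prodℕ p c * prodℕ r (c ∘ (p ℕ.+_) ∘ (q ℕ.+_))
    × linearSum M b e ≈ sumℕ q (e ∘ (p ℕ.+_))
  false-true-false-blocks p q r b e c ≡.refl first middle last =
      ≡.trans (#linear-+ p (q ℕ.+ r) b)
        (≡.trans (≡.cong₂ ℕ._+_ (#linear-false p b first)
                   (≡.trans (#linear-+ q r b′)
                            (≡.cong₂ ℕ._+_ (#linear-true q b′ middle) (#linear-false r b″ last))))
                 (ℕ.+-identityʳ q))
    , (begin
        constantPart (p ℕ.+ (q ℕ.+ r)) b c
          ≈⟨ prodℕ-+ p (q ℕ.+ r) _ ⟩
        constantPart p b c * constantPart (q ℕ.+ r) b′ c′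
          ≈⟨ *-cong (constantPart-false p b c first) (prodℕ-+ q r _) ⟩
        prodℕ p c * (constantPart q b′ c′ * constantPart r b″ c″)
          ≈⟨ *-cong refl (*-cong (constantPart-true q b′ c′ middle)
                                 (constantPart-false r b″ c″ last)) ⟩
        prodℕ p c * (1# * prodℕ r c″)
          ≈⟨ *-cong refl (*-identityˡ _) ⟩
        prodℕ p c * prodℕ r c″ ∎)
    , (begin
        linearSum (p ℕ.+ (q ℕ.+ r)) b e
          ≈⟨ sumℕ-+ p (q ℕ.+ r) _ ⟩
        linearSum p b e + linearSum (q ℕ.+ r) b′ e′
          ≈⟨ +-cong (linearSum-false p b e first) (sumℕ-+ q r _) ⟩
        0# + (linearSum q b′ e′ + linearSum r b″ e″)
          ≈⟨ +-cong refl (+-cong (linearSum-true q b′ e′ middle)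
                                 (linearSum-false r b″ e″ last)) ⟩
        0# + (sumℕ q e′ + 0#)
          ≈⟨ trans (+-identityˡ _) (+-identityʳ _) ⟩
        sumℕ q e′ ∎)
    where
    b′ b″ : ℕ → Bool
    b′ = b ∘ (p ℕ.+_)
    b″ = b′ ∘ (q ℕ.+_)
    c′ c″ e′ e″ : ℕ → Carrier
    c′ = c ∘ (p ℕ.+_)
    c″ = c′ ∘ (q ℕ.+_)
    e′ = e ∘ (p ℕ.+_)
    e″ = e′ ∘ (q ℕ.+_)

≡ᵇ-true : ∀ {r c} → r ≡ c → (r ℕ.≡ᵇ c) ≡ true
≡ᵇ-true {r} {c} r≡c with r ℕ.≡ᵇ c | ℕ.≡⇒≡ᵇ r c r≡c
... | true | _ = ≡.refl

≡ᵇ-false : ∀ {r c} → r ≢ c → (r ℕ.≡ᵇ c) ≡ false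
≡ᵇ-false {r} {c} r≢c with r ℕ.≡ᵇ c | ℕ.≡ᵇ⇒≡ r c
... | false | _   = ≡.refl
... | true  | r≡c = ⊥-elim (r≢c (r≡c _))

punchInℕ : ℕ → ℕ → ℕ
punchInℕ i t = if t ℕ.<ᵇ i then t else suc t

punchInℕ-< : ∀ {i t} → t < i → punchInℕ i t ≡ t
punchInℕ-< {i} {t} t<i with t ℕ.<ᵇ i | ℕ.<⇒<ᵇ t<i
... | true | _ = ≡.refl

punchInℕ-≥ : ∀ {i t} → i ≤ t → punchInℕ i t ≡ suc t
punchInℕ-≥ {i} {t} i≤t with t ℕ.<ᵇ i | ℕ.<ᵇ⇒< t i
... | false | _   = ≡.refl
... | true  | t<i = ⊥-elim (ℕ.<⇒≱ (t<i _) i≤t)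

punchInℕ-suc : ∀ i t → suc (punchInℕ i t) ≡ punchInℕ (suc i) (suc t)
punchInℕ-suc i t with t ℕ.<ᵇ i
... | true  = ≡.refl
... | false = ≡.refl

toℕ-punchIn : ∀ {N} (i : Fin (suc N)) j → toℕ (punchIn i j) ≡ punchInℕ (toℕ i) (toℕ j)
toℕ-punchIn F.zero     j         = ≡.refl
toℕ-punchIn (F.suc i) F.zero     = ≡.refl
toℕ-punchIn (F.suc i) (F.suc j) = ≡.trans (≡.cong suc (toℕ-punchIn i j)) (punchInℕ-suc (toℕ i) (toℕ j))

toℕ-punchIn-< : ∀ {N} (i : Fin (suc N)) j → toℕ j < toℕ i → toℕ (punchIn i j) ≡ toℕ j
toℕ-punchIn-< i j j<i = ≡.trans (toℕ-punchIn i j) (punchInℕ-< j<i)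

toℕ-punchIn-≥ : ∀ {N} (i : Fin (suc N)) j → toℕ i ≤ toℕ j → toℕ (punchIn i j) ≡ suc (toℕ j)
toℕ-punchIn-≥ i j i≤j = ≡.trans (toℕ-punchIn i j) (punchInℕ-≥ i≤j)

toℕ-≤-punchIn : ∀ {N} (i : Fin (suc N)) j → toℕ j ≤ toℕ (punchIn i j)
toℕ-≤-punchIn F.zero     j         = ℕ.n≤1+n (toℕ j)
toℕ-≤-punchIn (F.suc i) F.zero     = z≤n
toℕ-≤-punchIn (F.suc i) (F.suc j) = s≤s (toℕ-≤-punchIn i j)

toℕ-punchIn-≤ : ∀ {N} (i : Fin (suc N)) j → toℕ (punchIn i j) ≤ suc (toℕ j)
toℕ-punchIn-≤ F.zero     j         = ℕ.≤-refl
toℕ-punchIn-≤ (F.suc i) F.zero     = z≤n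
toℕ-punchIn-≤ (F.suc i) (F.suc j) = s≤s (toℕ-punchIn-≤ i j)

≢fromℕ⇒< : ∀ {M} (j : Fin (suc M)) → j ≢ F.fromℕ M → toℕ j < M
≢fromℕ⇒< {M} j j≢last = ℕ.≤∧≢⇒< (F.toℕ≤pred[n] j)
  (λ j≡M → j≢last (F.toℕ-injective (≡.trans j≡M (≡.sym (F.toℕ-fromℕ M)))))

punchIn-mono-< : ∀ {N} (i : Fin (suc N)) → punchIn i Preserves F._<_ ⟶ F._<_
punchIn-mono-< i {x} {y} x<y = ℕ.≤∧≢⇒< (F.punchIn-mono-≤ i x y (ℕ.<⇒≤ x<y))
  (λ eq → ℕ.<⇒≢ x<y (≡.cong toℕ (F.punchIn-injective i x y (F.toℕ-injective eq))))

rotate : ∀ {M} → Fin (suc M) → Fin (suc M)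
rotate {M} F.zero    = F.fromℕ M
rotate {M} (F.suc x) = punchIn (F.fromℕ M) x

rotateℕ : ℕ → ℕ → ℕ
rotateℕ M zero    = M
rotateℕ M (suc t) = t

toℕ-rotate : ∀ {M} (x : Fin (suc M)) → toℕ (rotate x) ≡ rotateℕ M (toℕ x)
toℕ-rotate {M} F.zero    = F.toℕ-fromℕ M
toℕ-rotate {M} (F.suc x) = ≡.trans (toℕ-punchIn (F.fromℕ M) x)
  (≡.trans (≡.cong (λ i → punchInℕ i (toℕ x)) (F.toℕ-fromℕ M)) (punchInℕ-< (F.toℕ<n x)))

module CycleIndex (ℓ : ℕ) where
  n : ℕ
  n = suc ℓ

  mod-toℕ : ∀ (i : Fin n) → toℕ i mod n ≡ i
  mod-toℕ i = F.toℕ-injective (≡.trans (F.toℕ-fromℕ< _) (m<n⇒m%n≡m (F.toℕ<n i)))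

  mod-cong : ∀ q q′ → q % n ≡ q′ % n → q mod n ≡ q′ mod n
  mod-cong q q′ eq = F.fromℕ<-cong _ _ eq _ _

  mod-periodic : ∀ q → (n ℕ.+ q) mod n ≡ q mod n
  mod-periodic q = mod-cong (n ℕ.+ q) q (≡.trans (≡.cong (_% n) (ℕ.+-comm n q)) ([m+n]%n≡m%n q n))

  toℕ-next : ∀ (i : Fin n) → toℕ (next i) ≡ suc (toℕ i) % n
  toℕ-next i = F.toℕ-fromℕ< _

  toℕ-next-< : ∀ (i : Fin n) → toℕ i < ℓ → toℕ (next i) ≡ suc (toℕ i)
  toℕ-next-< i i<ℓ = ≡.trans (toℕ-next i) (m<n⇒m%n≡m (s≤s i<ℓ))

  toℕ-next-last : ∀ (i : Fin n) → toℕ i ≡ ℓ → toℕ (next i) ≡ 0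
  toℕ-next-last i i≡ℓ = ≡.trans (toℕ-next i) (≡.trans (≡.cong (λ t → suc t % n) i≡ℓ) (n%n≡0 n))

  iter-mod : ∀ t (i : Fin n) → iter t i ≡ (toℕ i ℕ.+ t) mod n
  iter-mod zero    i = ≡.sym (≡.trans (≡.cong (_mod n) (ℕ.+-identityʳ (toℕ i))) (mod-toℕ i))
  iter-mod (suc t) i =
    ≡.trans (iter-mod t (next i)) (mod-cong (toℕ (next i) ℕ.+ t) (toℕ i ℕ.+ suc t) (begin
      (toℕ (next i) ℕ.+ t) % n    ≡⟨ ≡.cong (λ r → (r ℕ.+ t) % n) (toℕ-next i) ⟩
      (q % n ℕ.+ t) % n           ≡⟨ %-distribˡ-+ (q % n) t n ⟩
      (q % n % n ℕ.+ t % n) % n   ≡⟨ ≡.cong (λ r → (r ℕ.+ t % n) % n) (m%n%n≡m%n q n) ⟩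
      (q % n ℕ.+ t % n) % n       ≡⟨ %-distribˡ-+ q t n ⟨
      (q ℕ.+ t) % n               ≡⟨ ≡.cong (_% n) (ℕ.+-suc (toℕ i) t) ⟨
      (toℕ i ℕ.+ suc t) % n       ∎))
    where
    open ≡.≡-Reasoning
    q : ℕ
    q = suc (toℕ i)

  steps-≤ : ∀ (a b : Fin n) → toℕ a ≤ toℕ b → steps a b ≡ toℕ b ∸ toℕ a
  steps-≤ a b a≤b with toℕ a ℕ.≤ᵇ toℕ b | ℕ.≤⇒≤ᵇ a≤b
  ... | true | _ = ≡.refl

  steps-> : ∀ (a b : Fin n) → toℕ b < toℕ a → steps a b ≡ (n ℕ.+ toℕ b) ∸ toℕ a
  steps-> a b b<a with toℕ a ℕ.≤ᵇ toℕ b | ℕ.≤ᵇ⇒≤ (toℕ a) (toℕ b)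
  ... | false | _   = ≡.refl
  ... | true  | a≤b = ⊥-elim (ℕ.<⇒≱ b<a (a≤b _))

  steps<n : ∀ (a b : Fin n) → steps a b < n
  steps<n a b with toℕ a ℕ.≤? toℕ b
  ... | yes a≤b =
    ≡.subst (_< n) (≡.sym (steps-≤ a b a≤b)) (ℕ.≤-<-trans (ℕ.m∸n≤m (toℕ b) (toℕ a)) (F.toℕ<n b))
  ... | no  a≰b = ≡.subst (_< n) (≡.sym (steps-> a b (ℕ.≰⇒> a≰b))) (s≤s (begin
    (n ℕ.+ toℕ b) ∸ toℕ a          ≤⟨ ℕ.∸-monoʳ-≤ (n ℕ.+ toℕ b) (ℕ.≰⇒> a≰b) ⟩
    (ℓ ℕ.+ toℕ b) ∸ toℕ b          ≡⟨ ℕ.m+n∸n≡m ℓ (toℕ b) ⟩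
    ℓ                              ∎))
    where open ℕ.≤-Reasoning

  steps≡0⇒≡ : ∀ (a b : Fin n) → steps a b ≡ 0 → a ≡ b
  steps≡0⇒≡ a b steps≡0 with toℕ a ℕ.≤? toℕ b
  ... | yes a≤b =
    F.toℕ-injective (ℕ.≤-antisym a≤b (ℕ.m∸n≡0⇒m≤n (≡.trans (≡.sym (steps-≤ a b a≤b)) steps≡0)))
  ... | no  a≰b = ⊥-elim (ℕ.<⇒≱ (F.toℕ<n a) (ℕ.≤-trans (ℕ.m≤m+n n (toℕ b))
                    (ℕ.m∸n≡0⇒m≤n (≡.trans (≡.sym (steps-> a b (ℕ.≰⇒> a≰b))) steps≡0))))

  prev-next : ∀ (b : Fin n) → prev (next b) ≡ b
  prev-next b =
    F.toℕ-injective (≡.trans (F.toℕ-fromℕ< _) (toℕ-prev-next (ℕ.m≤n⇒m<n∨m≡n (F.toℕ≤pred[n] b))))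
    where
    toℕ-prev-next : toℕ b < ℓ ⊎ toℕ b ≡ ℓ → (toℕ (next b) ℕ.+ ℓ) % n ≡ toℕ b
    toℕ-prev-next (inj₁ b<ℓ) = begin
      (toℕ (next b) ℕ.+ ℓ) % n   ≡⟨ ≡.cong (λ q → (q ℕ.+ ℓ) % n) (toℕ-next-< b b<ℓ) ⟩
      (suc (toℕ b) ℕ.+ ℓ) % n    ≡⟨ ≡.cong (_% n) (ℕ.+-suc (toℕ b) ℓ) ⟨
      (toℕ b ℕ.+ n) % n          ≡⟨ [m+n]%n≡m%n (toℕ b) n ⟩
      toℕ b % n                  ≡⟨ m<n⇒m%n≡m (F.toℕ<n b) ⟩
      toℕ b                      ∎
      where open ≡.≡-Reasoning
    toℕ-prev-next (inj₂ b≡ℓ) = ≡.trans (≡.cong (λ q → (q ℕ.+ ℓ) % n) (toℕ-next-last b b≡ℓ))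
                                       (≡.trans (m<n⇒m%n≡m (ℕ.n<1+n ℓ)) (≡.sym b≡ℓ))

  steps-next≢0 : ∀ (a b : Fin n) → b ≢ prev a → steps (next b) a ≢ 0
  steps-next≢0 a b b≢prev steps≡0 =
    b≢prev (≡.trans (≡.sym (prev-next b)) (≡.cong prev (steps≡0⇒≡ (next b) a steps≡0)))

  steps-next-≤ : ∀ (a b : Fin n) → toℕ a ≤ toℕ b → steps (next b) a ≡ (ℓ ∸ toℕ b) ℕ.+ toℕ a
  steps-next-≤ a b a≤b with ℕ.m≤n⇒m<n∨m≡n (F.toℕ≤pred[n] b)
  ... | inj₁ b<ℓ = begin
    steps (next b) a
      ≡⟨ steps-> (next b) a (≡.subst (toℕ a <_) (≡.sym (toℕ-next-< b b<ℓ)) (s≤s a≤b)) ⟩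
    (n ℕ.+ toℕ a) ∸ toℕ (next b)
      ≡⟨ ≡.cong ((n ℕ.+ toℕ a) ∸_) (toℕ-next-< b b<ℓ) ⟩
    (ℓ ℕ.+ toℕ a) ∸ toℕ b
      ≡⟨ ℕ.+-∸-comm (toℕ a) (ℕ.<⇒≤ b<ℓ) ⟩
    (ℓ ∸ toℕ b) ℕ.+ toℕ a ∎
    where open ≡.≡-Reasoning
  ... | inj₂ b≡ℓ = begin
    steps (next b) a
      ≡⟨ steps-≤ (next b) a (≡.subst (_≤ toℕ a) (≡.sym (toℕ-next-last b b≡ℓ)) z≤n) ⟩
    toℕ a ∸ toℕ (next b)
      ≡⟨ ≡.cong (toℕ a ∸_) (toℕ-next-last b b≡ℓ) ⟩
    toℕ a
      ≡⟨ ≡.cong (ℕ._+ toℕ a) (≡.trans (≡.cong (ℓ ∸_) b≡ℓ) (ℕ.n∸n≡0 ℓ)) ⟨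
    (ℓ ∸ toℕ b) ℕ.+ toℕ a ∎
    where open ≡.≡-Reasoning

  steps-next-> : ∀ (a b : Fin n) → toℕ b < toℕ a → steps (next b) a ≡ toℕ a ∸ suc (toℕ b)
  steps-next-> a b b<a = ≡.trans (steps-≤ (next b) a (≡.subst (_≤ toℕ a) (≡.sym next≡) b<a))
                                 (≡.cong (toℕ a ∸_) next≡)
    where
    next≡ : toℕ (next b) ≡ suc (toℕ b)
    next≡ = toℕ-next-< b (ℕ.<-≤-trans b<a (F.toℕ≤pred[n] a))

module CycleMatrix (R : CommutativeRing 0ℓ 0ℓ) (m : ℕ) (In Out Leak : Subset (suc (suc m)))
                   (k : Fin (suc (suc m)) → Fin (suc (suc m)) → CommutativeRing.Carrier R)
                   (k0 : Fin (suc (suc m)) → CommutativeRing.Carrier R) where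
  open CommutativeRing R hiding (zero)
  open Alg R
  open RingArithmetic R
  open Polynomials R
  open Determinants R
  open FactorProducts R
  open import Algebra.Properties.Ring ring using (-0#≈0#; -‿involutive; -‿+-comm)
  open import Relation.Binary.Reasoning.Setoid setoid

  ℓ : ℕ
  ℓ = suc m

  open CycleIndex ℓ

  N : Matrix n
  N = charMatrix (cycleModel In Out Leak) k k0

  E : Fin n → Carrier
  E = eElt Leak k k0

  N-diagonal : ∀ (i : Fin n) → N i i ≋ factor true (E i) 0#
  N-diagonal i with i F.≟ i
  ... | no i≢i = ⊥-elim (i≢i ≡.refl)
  ... | yes _  = coeffwise λ
    { zero          → trans (+-identityˡ _) (begin
        - (- S + - leakTerm Leak k0 i)     ≈⟨ -‿cong (-‿+-comm S _) ⟩
        - - (S + leakTerm Leak k0 i)       ≈⟨ -‿involutive _ ⟩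
        S + leakTerm Leak k0 i             ≈⟨ +-cong outflow refl ⟩
        E i                                ∎)
    ; (suc zero)    → refl
    ; (suc (suc d)) → refl }
    where
    S : Carrier
    S = sumR (λ p → if does (p F.≟ next i) then k p i else 0#)
    outflow : S ≈ kc k i
    outflow = trans (sumR-single (λ p → if does (p F.≟ next i) then k p i else 0#) (next i)
                                 λ p p≢next → if-false (dec-false (p F.≟ next i) p≢next))
                    (if-true (dec-true (next i F.≟ next i) ≡.refl))

  next≢ : ∀ (j : Fin n) → next j ≢ j
  next≢ j next≡j with ℕ.m≤n⇒m<n∨m≡n (F.toℕ≤pred[n] j)
  ... | inj₁ j<ℓ = ℕ.1+n≢n (≡.trans (≡.sym (toℕ-next-< j j<ℓ)) (≡.cong toℕ next≡j))
  ... | inj₂ j≡ℓ =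
    ℕ.0≢1+n (≡.trans (≡.sym (toℕ-next-last j j≡ℓ)) (≡.trans (≡.cong toℕ next≡j) j≡ℓ))

  N-subdiagonal : ∀ (j : Fin n) → N (next j) j ≋ factor false 0# (- kc k j)
  N-subdiagonal j with next j F.≟ j
  ... | yes next≡j = ⊥-elim (next≢ j next≡j)
  ... | no _       = coeffwise λ
    { zero    → -‿cong (if-true (dec-true (next j F.≟ next j) ≡.refl))
    ; (suc d) → refl }

  N-zero : ∀ (i j : Fin n) → i ≢ j → i ≢ next j → N i j ≋ []
  N-zero i j i≢j i≢next with i F.≟ j
  ... | yes i≡j = ⊥-elim (i≢j i≡j)
  ... | no _    = coeffwise λ
    { zero    → trans (-‿cong (if-false (dec-false (i F.≟ next j) i≢next))) -0#≈0#
    ; (suc d) → refl }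

  -- The positions (toℕ i, toℕ j) at which N i j can be nonzero.
  data Adjacent (r c : ℕ) : Set where
    diagonal    : r ≡ c → Adjacent r c
    subdiagonal : r ≡ suc c → Adjacent r c
    corner      : r ≡ 0 → c ≡ ℓ → Adjacent r c

  next-adjacent : ∀ (i j : Fin n) → i ≡ next j → Adjacent (toℕ i) (toℕ j)
  next-adjacent _ j ≡.refl with ℕ.m≤n⇒m<n∨m≡n (F.toℕ≤pred[n] j)
  ... | inj₁ j<ℓ = subdiagonal (toℕ-next-< j j<ℓ)
  ... | inj₂ j≡ℓ = corner (toℕ-next-last j j≡ℓ) j≡ℓ

  adjacent-next : ∀ (i j : Fin n) → toℕ i ≢ toℕ j → Adjacent (toℕ i) (toℕ j) → i ≡ next j
  adjacent-next i j i≢j (diagonal i≡j)      = ⊥-elim (i≢j i≡j)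
  adjacent-next i j _   (subdiagonal i≡1+j) =
    F.toℕ-injective (≡.trans i≡1+j (≡.sym (toℕ-next-< j (ℕ.≤-pred (≡.subst (_< n) i≡1+j (F.toℕ<n i))))))
  adjacent-next i j _   (corner i≡0 j≡ℓ)    =
    F.toℕ-injective (≡.trans i≡0 (≡.sym (toℕ-next-last j j≡ℓ)))

  N-non-adjacent : ∀ (i j : Fin n) → ¬ Adjacent (toℕ i) (toℕ j) → N i j ≋ []
  N-non-adjacent i j ¬adj =
    N-zero i j (λ i≡j → ¬adj (diagonal (≡.cong toℕ i≡j))) (¬adj ∘ next-adjacent i j)

  N-first-row : ∀ (j : Fin n) → 0 < toℕ j → toℕ j < ℓ → N F.zero j ≋ []
  N-first-row j 0<j j<ℓ = N-non-adjacent F.zero j λ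
    { (diagonal 0≡j) → ℕ.<⇒≢ 0<j 0≡j
    ; (corner _ j≡ℓ) → ℕ.<⇒≢ j<ℓ j≡ℓ }

  Eℕ : ℕ → Carrier
  Eℕ q = E (q mod n)

  Kℕ : ℕ → Carrier
  Kℕ q = kc k (q mod n)

  Eℕ-toℕ : ∀ (i : Fin n) → Eℕ (toℕ i) ≡ E i
  Eℕ-toℕ i = ≡.cong E (mod-toℕ i)

  Kℕ-toℕ : ∀ (i : Fin n) → Kℕ (toℕ i) ≡ kc k i
  Kℕ-toℕ i = ≡.cong (kc k) (mod-toℕ i)

  Eℕ-periodic : ∀ q → Eℕ (n ℕ.+ q) ≡ Eℕ q
  Eℕ-periodic q = ≡.cong E (mod-periodic q)

  Kℕ-periodic : ∀ q → Kℕ (n ℕ.+ q) ≡ Kℕ q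
  Kℕ-periodic q = ≡.cong (kc k) (mod-periodic q)

  N-adjacent : ∀ (i j : Fin n) → Adjacent (toℕ i) (toℕ j) →
    N i j ≋ factor (toℕ i ℕ.≡ᵇ toℕ j) (Eℕ (toℕ i)) (- Kℕ (toℕ j))
  N-adjacent i j adj with toℕ i ℕ.≟ toℕ j
  ... | yes i≡j rewrite ≡ᵇ-true i≡j | F.toℕ-injective i≡j | Eℕ-toℕ j = N-diagonal j
  ... | no  i≢j rewrite ≡ᵇ-false i≢j | adjacent-next i j i≢j adj | Kℕ-toℕ j = N-subdiagonal j

  labelled-factors : ∀ {M} (X Y : Fin M → Fin n) (r c : ℕ → ℕ) →
    (∀ x → toℕ (X x) ≡ r (toℕ x)) → (∀ x → toℕ (Y x) ≡ c (toℕ x)) →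
    (∀ t → t < M → Adjacent (r t) (c t)) →
    Factors (λ x → N (X x) (Y x)) (λ t → r t ℕ.≡ᵇ c t) (Eℕ ∘ r) (λ t → - Kℕ (c t))
  labelled-factors X Y r c X≡r Y≡c adjacent = factors λ x →
    ≡.subst₂ (λ a b → N (X x) (Y x) ≋ factor (a ℕ.≡ᵇ b) (Eℕ a) (- Kℕ b)) (X≡r x) (Y≡c x)
      (N-adjacent (X x) (Y x)
        (≡.subst₂ Adjacent (≡.sym (X≡r x)) (≡.sym (Y≡c x)) (adjacent (toℕ x) (F.toℕ<n x))))

  det-bidiagonal-N : ∀ {M} (X Y : Fin M → Fin n) →
    X Preserves F._<_ ⟶ F._<_ → Y Preserves F._<_ ⟶ F._<_ → (∀ x → 0 < toℕ (X x)) →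
    det (λ x y → N (X x) (Y y)) ≋ prodP (λ x → N (X x) (Y x))
  det-bidiagonal-N X Y X↑ Y↑ X>0 = det-bidiagonal _ (toℕ ∘ X) (toℕ ∘ Y) X↑ Y↑
    (λ x y r<c → N-non-adjacent (X x) (Y y) λ
      { (diagonal r≡c)      → ℕ.<⇒≢ r<c r≡c
      ; (subdiagonal r≡1+c) → ℕ.<-asym r<c (≡.subst (toℕ (Y y) <_) (≡.sym r≡1+c) (ℕ.n<1+n _))
      ; (corner r≡0 _)      → ℕ.<⇒≢ (X>0 x) (≡.sym r≡0) })
    (λ x y 1+c<r → N-non-adjacent (X x) (Y y) λ
      { (diagonal r≡c)      → ℕ.<-asym 1+c<r (≡.subst (_< suc (toℕ (Y y))) (≡.sym r≡c) (ℕ.n<1+n _))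
      ; (subdiagonal r≡1+c) → ℕ.<-irrefl (≡.sym r≡1+c) 1+c<r
      ; (corner r≡0 _)      → ℕ.<⇒≢ (X>0 x) (≡.sym r≡0) })

  det-bidiagonal-N-zero : ∀ {M} (X Y : Fin M → Fin n) →
    X Preserves F._<_ ⟶ F._<_ → Y Preserves F._<_ ⟶ F._<_ → (∀ x → 0 < toℕ (X x)) →
    ∀ x → ¬ Adjacent (toℕ (X x)) (toℕ (Y x)) → det (λ x y → N (X x) (Y y)) ≋ []
  det-bidiagonal-N-zero X Y X↑ Y↑ X>0 x ¬adj =
    ≋-trans (det-bidiagonal-N X Y X↑ Y↑ X>0) (prodP-zero _ x (N-non-adjacent (X x) (Y x) ¬adj))

  diagonalProduct cycleProduct : Pol
  diagonalProduct = prodP (λ x → N x x)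
  cycleProduct    = prodP (λ x → N x (rotate x))

  diagonal-factors : Factors (λ x → N x x) (λ _ → true) Eℕ (λ _ → 0#)
  diagonal-factors = factors λ x →
    ≡.subst (λ e → N x x ≋ factor true e 0#) (≡.sym (Eℕ-toℕ x)) (N-diagonal x)

  cycleLinear : ℕ → Bool
  cycleLinear t = t ℕ.≡ᵇ rotateℕ ℓ t

  cycleConstant : ℕ → Carrier
  cycleConstant t = - Kℕ (rotateℕ ℓ t)

  cycle-factors : Factors (λ x → N x (rotate x)) cycleLinear Eℕ cycleConstant
  cycle-factors =
    labelled-factors (λ x → x) rotate (λ t → t) (rotateℕ ℓ) (λ _ → ≡.refl) toℕ-rotate adjacent
    where
    adjacent : ∀ t → t < n → Adjacent t (rotateℕ ℓ t)
    adjacent zero    _ = corner ≡.refl ≡.refl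
    adjacent (suc t) _ = subdiagonal ≡.refl

  cycle-all-constant : ConstantOn n cycleLinear false
  cycle-all-constant zero    _ = ≡.refl
  cycle-all-constant (suc t) _ = ≡ᵇ-false (ℕ.1+n≢n {t})

  det-N : det N ≋ diagonalProduct ⊕ signP ℓ cycleProduct
  det-N = ≋-trans (det-first-and-last-term N first-row) (⊕-cong first-term last-term)
    where
    first-row : ∀ j → j ≢ F.zero → j ≢ F.fromℕ ℓ → N F.zero j ≋ []
    first-row F.zero     0≢0 _      = ⊥-elim (0≢0 ≡.refl)
    first-row (F.suc j) _   j≢last = N-first-row (F.suc j) (s≤s z≤n) (≢fromℕ⇒< (F.suc j) j≢last)
    first-term : cofactorTerm N F.zero ≋ diagonalProduct
    first-term = ⊗-cong (≋-refl {N F.zero F.zero}) (det-bidiagonal-N F.suc F.suc s≤s s≤s (λ _ → s≤s z≤n))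
    last-term : cofactorTerm N (F.fromℕ ℓ) ≋ signP ℓ cycleProduct
    last-term = ≡.subst (λ e → cofactorTerm N (F.fromℕ ℓ) ≋ signP e cycleProduct) (F.toℕ-fromℕ ℓ)
      (signP-cong (toℕ (F.fromℕ ℓ)) (⊗-cong (≋-refl {N F.zero (F.fromℕ ℓ)})
        (det-bidiagonal-N F.suc (punchIn (F.fromℕ ℓ)) s≤s (punchIn-mono-< (F.fromℕ ℓ)) (λ _ → s≤s z≤n))))

  coeff-det-N : ∀ s → coeff (det N) s ≈ coeff diagonalProduct s + sign ℓ (coeff cycleProduct s)
  coeff-det-N s = trans (coeff-≈ det-N s) (trans (coeff-⊕ diagonalProduct _ s) (+-cong refl (coeff-signP ℓ _ s)))

  coeff-diagonalProduct : ∀ s d → s ℕ.+ d ≡ n → coeff diagonalProduct s ≈ esym d (Eset Leak k k0)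
  coeff-diagonalProduct s d s+d≡n = begin
    coeff diagonalProduct s
      ≈⟨ coeff-prodP diagonal-factors s d (≡.trans s+d≡n (≡.sym (#linear-true n _ λ _ _ → ≡.refl))) ⟩
    constantPart n (λ _ → true) (λ _ → 0#) * esym d (linearTerms n (λ _ → true) Eℕ)
      ≈⟨ *-cong (constantPart-true n (λ _ → true) (λ _ → 0#) λ _ _ → ≡.refl) refl ⟩
    1# * esym d (linearTerms n (λ _ → true) Eℕ)
      ≈⟨ *-identityˡ _ ⟩
    esym d (linearTerms n (λ _ → true) Eℕ)
      ≡⟨ ≡.cong (esym d) (≡.trans (linearTerms-true n Eℕ) (tabulate-cong Eℕ-toℕ)) ⟩
    esym d (Eset Leak k k0) ∎

  coeff-cycleProduct-above : ∀ s → 0 < s → coeff cycleProduct s ≈ 0#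
  coeff-cycleProduct-above s 0<s = coeff-prodP-above cycle-factors s
    (≡.subst (_< s) (≡.sym (#linear-false n cycleLinear cycle-all-constant)) 0<s)

  coeff-cycleProduct-zero : sign ℓ (coeff cycleProduct 0) ≈ - prodR (kc k)
  coeff-cycleProduct-zero = begin
    sign ℓ (coeff cycleProduct 0)
      ≈⟨ sign-cong ℓ (coeff-prodP cycle-factors 0 0 (≡.sym (#linear-false n cycleLinear cycle-all-constant))) ⟩
    sign ℓ (constantPart n cycleLinear cycleConstant * 1#)
      ≈⟨ sign-cong ℓ (trans (*-identityʳ _) (constantPart-false n cycleLinear cycleConstant cycle-all-constant)) ⟩
    sign ℓ (prodℕ n (λ t → - Kℕ (rotateℕ ℓ t)))
      ≈⟨ sign-cong ℓ (prodℕ-neg n (Kℕ ∘ rotateℕ ℓ)) ⟩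
    sign ℓ (sign n (Kℕ ℓ * prodℕ ℓ Kℕ))
      ≈⟨ sign-sign ℓ n _ ⟩
    sign (ℓ ℕ.+ n) (Kℕ ℓ * prodℕ ℓ Kℕ)
      ≈⟨ sign-odd (ℓ ℕ.+ n) ℓ _ (ℕ.+-suc ℓ ℓ) ⟩
    - (Kℕ ℓ * prodℕ ℓ Kℕ)
      ≈⟨ -‿cong (trans (*-comm _ _) (sym (prodℕ-suc ℓ Kℕ))) ⟩
    - prodℕ n Kℕ
      ≈⟨ -‿cong (prodR≈prodℕ (kc k) Kℕ (reflexive ∘ ≡.sym ∘ Kℕ-toℕ)) ⟨
    - prodR (kc k) ∎

  coeff-det-N-nonconstant : ∀ s d → s ℕ.+ d ≡ n → 0 < s → coeff (det N) s ≈ esym d (Eset Leak k k0)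
  coeff-det-N-nonconstant s d s+d≡n 0<s = begin
    coeff (det N) s
      ≈⟨ coeff-det-N s ⟩
    coeff diagonalProduct s + sign ℓ (coeff cycleProduct s)
      ≈⟨ +-cong (coeff-diagonalProduct s d s+d≡n)
                (trans (sign-cong ℓ (coeff-cycleProduct-above s 0<s)) (sign-zero ℓ)) ⟩
    esym d (Eset Leak k k0) + 0#
      ≈⟨ +-identityʳ _ ⟩
    esym d (Eset Leak k k0) ∎

  coeff-det-N-constant : coeff (det N) 0 ≈ esym n (Eset Leak k k0) + - prodR (kc k)
  coeff-det-N-constant =
    trans (coeff-det-N 0) (+-cong (coeff-diagonalProduct 0 n ≡.refl) coeff-cycleProduct-zero)

  -- The diagonal factor at position a′ below the first row lies in row a + 1 and column a − 1.
  corner-column-vanishes : ∀ (a′ : Fin ℓ) (b : Fin n) (j : Fin m) → suc (toℕ a′) ≤ toℕ b →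
    toℕ (punchIn b (F.suc j)) ≡ ℓ → TermVanishes (minor N (F.suc a′) b) (F.suc j)
  corner-column-vanishes a′ b j a≤b c≡ℓ =
    inj₂ (det-bidiagonal-N-zero (punchIn a ∘ F.suc) (punchIn b ∘ punchIn (F.suc j))
            (punchIn-mono-< a ∘ s≤s) (punchIn-mono-< b ∘ punchIn-mono-< (F.suc j)) (λ _ → s≤s z≤n)
            x ¬adjacent)
    where
    a : Fin n
    a = F.suc a′
    b≤1+j : toℕ b ≤ suc (toℕ j)
    b≤1+j = ℕ.≮⇒≥ λ 1+j<b →
      ℕ.<⇒≢ (F.toℕ<n (F.suc j)) (≡.trans (≡.sym (toℕ-punchIn-< b (F.suc j) 1+j<b)) c≡ℓ)
    a′<1+j : toℕ a′ < suc (toℕ j)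
    a′<1+j = ℕ.≤-trans a≤b b≤1+j
    x : Fin m
    x = F.fromℕ< (ℕ.<-≤-trans a′<1+j (F.toℕ≤pred[n] (F.suc j)))
    x≡a′ : toℕ x ≡ toℕ a′
    x≡a′ = F.toℕ-fromℕ< _
    row : toℕ (punchIn a (F.suc x)) ≡ suc (suc (toℕ a′))
    row = ≡.trans (toℕ-punchIn-≥ a (F.suc x) (s≤s (ℕ.≤-reflexive (≡.sym x≡a′))))
                  (≡.cong (suc ∘ suc) x≡a′)
    inner : toℕ (punchIn (F.suc j) x) ≡ toℕ a′
    inner = ≡.trans (toℕ-punchIn-< (F.suc j) x (≡.subst (_< suc (toℕ j)) (≡.sym x≡a′) a′<1+j)) x≡a′
    column : toℕ (punchIn b (punchIn (F.suc j) x)) ≡ toℕ a′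
    column = ≡.trans (toℕ-punchIn-< b _ (≡.subst (_< toℕ b) (≡.sym inner) a≤b)) inner
    ¬adjacent : ¬ Adjacent (toℕ (punchIn a (F.suc x))) (toℕ (punchIn b (punchIn (F.suc j) x)))
    ¬adjacent (diagonal r≡c)      =
      ℕ.<⇒≢ (ℕ.m<n⇒m<1+n (ℕ.n<1+n _)) (≡.trans (≡.sym column) (≡.trans (≡.sym r≡c) row))
    ¬adjacent (subdiagonal r≡1+c) = ℕ.1+n≢n (≡.trans (≡.sym row) (≡.trans r≡1+c (≡.cong suc column)))
    ¬adjacent (corner r≡0 _)      = ℕ.0≢1+n (≡.trans (≡.sym r≡0) row)

  -- The diagonal factor at position b − 1 below the first row lies in row b and column b + 1.
  first-column-vanishes : ∀ (a′ : Fin ℓ) (b : Fin n) → toℕ b < suc (toℕ a′) → 0 < m →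
    TermVanishes (minor N (F.suc a′) b) F.zero
  first-column-vanishes a′ F.zero      _   0<m = inj₁ (N-first-row (F.suc F.zero) (s≤s z≤n) (s≤s 0<m))
  first-column-vanishes a′ (F.suc b′) b<a _   =
    inj₂ (det-bidiagonal-N-zero (punchIn a ∘ F.suc) (punchIn b ∘ F.suc)
            (punchIn-mono-< a ∘ s≤s) (punchIn-mono-< b ∘ s≤s) (λ _ → s≤s z≤n) x ¬adjacent)
    where
    a b : Fin n
    a = F.suc a′
    b = F.suc b′
    b′<a′ : toℕ b′ < toℕ a′
    b′<a′ = ℕ.s≤s⁻¹ b<a
    x : Fin m
    x = F.fromℕ< (ℕ.<-≤-trans b′<a′ (F.toℕ≤pred[n] a′))
    x≡b′ : toℕ x ≡ toℕ b′
    x≡b′ = F.toℕ-fromℕ< _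
    row : toℕ (punchIn a (F.suc x)) ≡ suc (toℕ b′)
    row = ≡.cong suc
      (≡.trans (toℕ-punchIn-< a′ x (≡.subst (_< toℕ a′) (≡.sym x≡b′) b′<a′)) x≡b′)
    column : toℕ (punchIn b (F.suc x)) ≡ suc (suc (toℕ b′))
    column = ≡.cong suc
      (≡.trans (toℕ-punchIn-≥ b′ x (ℕ.≤-reflexive (≡.sym x≡b′))) (≡.cong suc x≡b′))
    ¬adjacent : ¬ Adjacent (toℕ (punchIn a (F.suc x))) (toℕ (punchIn b (F.suc x)))
    ¬adjacent (diagonal r≡c)      = ℕ.1+n≢n (≡.sym (≡.trans (≡.sym row) (≡.trans r≡c column)))
    ¬adjacent (subdiagonal r≡1+c) =
      ℕ.<-irrefl (≡.trans (≡.sym row) (≡.trans r≡1+c (≡.cong suc column))) (ℕ.m<n⇒m<1+n (ℕ.n<1+n _))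
    ¬adjacent (corner r≡0 _)      = ℕ.0≢1+n (≡.trans (≡.sym r≡0) row)

  minor-det-≤ : ∀ (a b : Fin n) → toℕ a ≤ toℕ b →
    det (minor N a b) ≋ prodP (λ x → N (punchIn a x) (punchIn b x))
  minor-det-≤ F.zero     b _   = det-bidiagonal-N F.suc (punchIn b) s≤s (punchIn-mono-< b) (λ _ → s≤s z≤n)
  minor-det-≤ (F.suc a′) b a≤b = ≋-trans (det-single-term (minor N a b) F.zero vanish)
    (⊗-cong (≋-refl {N F.zero (punchIn b F.zero)})
      (det-bidiagonal-N (punchIn a ∘ F.suc) (punchIn b ∘ F.suc)
                        (punchIn-mono-< a ∘ s≤s) (punchIn-mono-< b ∘ s≤s) (λ _ → s≤s z≤n)))
    where
    a : Fin n
    a = F.suc a′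
    vanish : ∀ j → j ≢ F.zero → TermVanishes (minor N a b) j
    vanish F.zero     0≢0 = ⊥-elim (0≢0 ≡.refl)
    vanish (F.suc j) _ with ℕ.m≤n⇒m<n∨m≡n (F.toℕ≤pred[n] (punchIn b (F.suc j)))
    ... | inj₁ c<ℓ =
      inj₁ (N-first-row (punchIn b (F.suc j)) (ℕ.<-≤-trans (s≤s z≤n) (toℕ-≤-punchIn b (F.suc j))) c<ℓ)
    ... | inj₂ c≡ℓ = corner-column-vanishes a′ b j a≤b c≡ℓ

  minor-det-> : ∀ (a b : Fin n) → toℕ b < toℕ a →
    det (minor N a b) ≋ signP m (prodP (λ x → N (punchIn a x) (punchIn b (rotate x))))
  minor-det-> (F.suc a′) b b<a = ≋-trans (det-single-term (minor N a b) (F.fromℕ m) vanish)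
    (≡.subst (λ e → cofactorTerm (minor N a b) (F.fromℕ m) ≋ signP e P) (F.toℕ-fromℕ m)
      (signP-cong (toℕ (F.fromℕ m)) (⊗-cong (≋-refl {N F.zero (punchIn b (F.fromℕ m))})
        (det-bidiagonal-N (punchIn a ∘ F.suc) (punchIn b ∘ punchIn (F.fromℕ m))
          (punchIn-mono-< a ∘ s≤s) (punchIn-mono-< b ∘ punchIn-mono-< (F.fromℕ m)) (λ _ → s≤s z≤n)))))
    where
    a : Fin n
    a = F.suc a′
    P : Pol
    P = prodP (λ x → N (punchIn a x) (punchIn b (rotate x)))
    vanish : ∀ j → j ≢ F.fromℕ m → TermVanishes (minor N a b) j
    vanish F.zero     0≢last = first-column-vanishes a′ b b<a (≢fromℕ⇒< F.zero 0≢last)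
    vanish (F.suc j) j≢last = inj₁ (N-first-row (punchIn b (F.suc j))
      (ℕ.<-≤-trans (s≤s z≤n) (toℕ-≤-punchIn b (F.suc j)))
      (ℕ.≤-<-trans (toℕ-punchIn-≤ b (F.suc j)) (s≤s (≢fromℕ⇒< (F.suc j) j≢last))))

  κ≈prodℕ : ∀ (a b : Fin n) → κ k a b ≈ prodℕ (steps a b) (λ t → Kℕ (toℕ a ℕ.+ t))
  κ≈prodℕ a b = prodℕ-cong (steps a b) λ t _ → reflexive (≡.cong (kc k) (iter-mod t a))

  e1*≈sumℕ : ∀ (a b : Fin n) →
    e1* Leak k k0 a b ≈ sumℕ (steps (next b) a) (λ t → Eℕ (toℕ b ℕ.+ suc t))
  e1*≈sumℕ a b = sumℕ-cong (steps (next b) a) λ t _ → reflexive (≡.cong E (iter-mod (suc t) b))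

  cofactor : Fin n → Fin n → Pol
  cofactor a b = signP (toℕ a ℕ.+ toℕ b) (det (minor N a b))

  -- The linear factors belong to the compartments off the path a → b, hence the degree.
  record CofactorShape (a b : Fin n) : Set where
    field
      sgn            : ℕ
      f              : Fin ℓ → Pol
      linear         : ℕ → Bool
      e c            : ℕ → Carrier
      isFactors      : Factors f linear e c
      coeff-cofactor : ∀ s → coeff (cofactor a b) s ≈ sign sgn (coeff (prodP f) s)
      degree         : #linear ℓ linear ≡ steps (next b) a
      leading        : sign sgn (constantPart ℓ linear c) ≈ κ k a b
      linear-sum     : linearSum ℓ linear e ≈ e1* Leak k k0 a b

  module Cofactor≤ (a b : Fin n) (a≤b : toℕ a ≤ toℕ b) where
    α β : ℕ
    α = toℕ a
    β = toℕ b

    linear : ℕ → Bool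
    linear t = punchInℕ α t ℕ.≡ᵇ punchInℕ β t

    e c : ℕ → Carrier
    e t = Eℕ (punchInℕ α t)
    c t = - Kℕ (punchInℕ β t)

    isFactors : Factors (λ x → N (punchIn a x) (punchIn b x)) linear e c
    isFactors =
      labelled-factors (punchIn a) (punchIn b) (punchInℕ α) (punchInℕ β) (toℕ-punchIn a) (toℕ-punchIn b) adjacent
      where
      adjacent : ∀ t → t < ℓ → Adjacent (punchInℕ α t) (punchInℕ β t)
      adjacent t _ with t ℕ.<? α | t ℕ.<? β
      ... | yes t<α | yes t<β = diagonal (≡.trans (punchInℕ-< t<α) (≡.sym (punchInℕ-< t<β)))
      ... | yes t<α | no  t≮β = ⊥-elim (t≮β (ℕ.<-≤-trans t<α a≤b))
      ... | no  t≮α | yes t<β =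
        subdiagonal (≡.trans (punchInℕ-≥ (ℕ.≮⇒≥ t≮α)) (≡.cong suc (≡.sym (punchInℕ-< t<β))))
      ... | no  t≮α | no  t≮β =
        diagonal (≡.trans (punchInℕ-≥ (ℕ.≮⇒≥ t≮α)) (≡.sym (punchInℕ-≥ (ℕ.≮⇒≥ t≮β))))

    α+[β∸α]≡β : α ℕ.+ (β ∸ α) ≡ β
    α+[β∸α]≡β = ℕ.m+[n∸m]≡n a≤b

    on-path<β : ∀ {s} → s < β ∸ α → α ℕ.+ s < β
    on-path<β s<β∸α = ≡.subst (_ <_) α+[β∸α]≡β (ℕ.+-monoʳ-< α s<β∸α)

    path-shift : ∀ s → α ℕ.+ ((β ∸ α) ℕ.+ s) ≡ β ℕ.+ s
    path-shift s = ≡.trans (≡.sym (ℕ.+-assoc α (β ∸ α) s)) (≡.cong (ℕ._+ s) α+[β∸α]≡β)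

    blocks : #linear ℓ linear ≡ α ℕ.+ (ℓ ∸ β)
             × constantPart ℓ linear c ≈ prodℕ (β ∸ α) (c ∘ (α ℕ.+_))
             × linearSum ℓ linear e ≈ sumℕ α e + sumℕ (ℓ ∸ β) (e ∘ (α ℕ.+_) ∘ ((β ∸ α) ℕ.+_))
    blocks = true-false-true-blocks α (β ∸ α) (ℓ ∸ β) linear e c
      (≡.trans (path-shift (ℓ ∸ β)) (ℕ.m+[n∸m]≡n (F.toℕ≤pred[n] b)))
      off-path-before on-path off-path-after
      where
      off-path-before : ConstantOn α linear true
      off-path-before t t<α =
        ≡ᵇ-true (≡.trans (punchInℕ-< t<α) (≡.sym (punchInℕ-< (ℕ.<-≤-trans t<α a≤b))))
      on-path : ConstantOn (β ∸ α) (linear ∘ (α ℕ.+_)) false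
      on-path s s<β∸α = ≡ᵇ-false λ r≡c → ℕ.1+n≢n (≡.trans (≡.sym (punchInℕ-≥ (ℕ.m≤m+n α s)))
        (≡.trans r≡c (punchInℕ-< (on-path<β s<β∸α))))
      off-path-after : ConstantOn (ℓ ∸ β) (linear ∘ (α ℕ.+_) ∘ ((β ∸ α) ℕ.+_)) true
      off-path-after s _ = ≡ᵇ-true (≡.trans (≡.cong (punchInℕ α) (path-shift s))
        (≡.trans (punchInℕ-≥ (ℕ.≤-trans a≤b (ℕ.m≤m+n β s)))
          (≡.trans (≡.sym (punchInℕ-≥ (ℕ.m≤m+n β s))) (≡.cong (punchInℕ β) (≡.sym (path-shift s))))))

    degree : #linear ℓ linear ≡ steps (next b) a
    degree = ≡.trans (proj₁ blocks) (≡.trans (ℕ.+-comm α (ℓ ∸ β)) (≡.sym (steps-next-≤ a b a≤b)))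

    leading : sign (α ℕ.+ β) (constantPart ℓ linear c) ≈ κ k a b
    leading = begin
      sign (α ℕ.+ β) (constantPart ℓ linear c)
        ≈⟨ sign-cong (α ℕ.+ β) (proj₁ (proj₂ blocks)) ⟩
      sign (α ℕ.+ β) (prodℕ (β ∸ α) (c ∘ (α ℕ.+_)))
        ≈⟨ sign-cong (α ℕ.+ β) (prodℕ-cong (β ∸ α) λ s s<β∸α →
            -‿cong (reflexive (≡.cong Kℕ (punchInℕ-< (on-path<β s<β∸α))))) ⟩
      sign (α ℕ.+ β) (prodℕ (β ∸ α) (λ s → - Kℕ (α ℕ.+ s)))
        ≈⟨ sign-cong (α ℕ.+ β) (prodℕ-neg (β ∸ α) _) ⟩
      sign (α ℕ.+ β) (sign (β ∸ α) P)
        ≈⟨ sign-sign (α ℕ.+ β) (β ∸ α) P ⟩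
      sign (α ℕ.+ β ℕ.+ (β ∸ α)) P
        ≈⟨ sign-even _ β P even ⟩
      P
        ≡⟨ ≡.cong (λ L → prodℕ L (λ t → Kℕ (α ℕ.+ t))) (steps-≤ a b a≤b) ⟨
      prodℕ (steps a b) (λ t → Kℕ (α ℕ.+ t))
        ≈⟨ κ≈prodℕ a b ⟨
      κ k a b ∎
      where
      P : Carrier
      P = prodℕ (β ∸ α) (λ s → Kℕ (α ℕ.+ s))
      even : α ℕ.+ β ℕ.+ (β ∸ α) ≡ β ℕ.+ β
      even = ≡.trans (ℕ.+-assoc α β (β ∸ α)) (≡.trans (≡.cong (α ℕ.+_) (ℕ.+-comm β (β ∸ α)))
               (≡.trans (≡.sym (ℕ.+-assoc α (β ∸ α) β)) (≡.cong (ℕ._+ β) α+[β∸α]≡β)))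

    linear-sum : linearSum ℓ linear e ≈ e1* Leak k k0 a b
    linear-sum = begin
      linearSum ℓ linear e
        ≈⟨ proj₂ (proj₂ blocks) ⟩
      sumℕ α e + sumℕ (ℓ ∸ β) (e ∘ (α ℕ.+_) ∘ ((β ∸ α) ℕ.+_))
        ≈⟨ +-cong (sumℕ-cong α λ t t<α → reflexive (≡.cong Eℕ (punchInℕ-< t<α)))
                   (sumℕ-cong (ℓ ∸ β) λ s _ → reflexive (≡.cong Eℕ (label-after-path s))) ⟩
      sumℕ α Eℕ + sumℕ (ℓ ∸ β) g
        ≈⟨ +-comm _ _ ⟩
      sumℕ (ℓ ∸ β) g + sumℕ α Eℕ
        ≈⟨ +-cong refl (sumℕ-cong α λ s _ →
             reflexive (≡.trans (≡.cong Eℕ (wrap s)) (Eℕ-periodic s))) ⟨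
      sumℕ (ℓ ∸ β) g + sumℕ α (λ s → g ((ℓ ∸ β) ℕ.+ s))
        ≈⟨ sumℕ-+ (ℓ ∸ β) α g ⟨
      sumℕ ((ℓ ∸ β) ℕ.+ α) g
        ≡⟨ ≡.cong (λ L → sumℕ L g) (steps-next-≤ a b a≤b) ⟨
      sumℕ (steps (next b) a) g
        ≈⟨ e1*≈sumℕ a b ⟨
      e1* Leak k k0 a b ∎
      where
      g : ℕ → Carrier
      g t = Eℕ (β ℕ.+ suc t)
      label-after-path : ∀ s → punchInℕ α (α ℕ.+ ((β ∸ α) ℕ.+ s)) ≡ β ℕ.+ suc s
      label-after-path s = ≡.trans (≡.cong (punchInℕ α) (path-shift s))
        (≡.trans (punchInℕ-≥ (ℕ.≤-trans a≤b (ℕ.m≤m+n β s))) (≡.sym (ℕ.+-suc β s)))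
      wrap : ∀ s → β ℕ.+ suc ((ℓ ∸ β) ℕ.+ s) ≡ n ℕ.+ s
      wrap s = ≡.trans (ℕ.+-suc β _) (≡.cong suc (≡.trans (≡.sym (ℕ.+-assoc β (ℓ ∸ β) s))
                 (≡.cong (ℕ._+ s) (ℕ.m+[n∸m]≡n (F.toℕ≤pred[n] b)))))

    shape : CofactorShape a b
    shape = record
      { sgn            = α ℕ.+ β
      ; isFactors      = isFactors
      ; coeff-cofactor = λ s →
          trans (coeff-signP (α ℕ.+ β) _ s) (sign-cong (α ℕ.+ β) (coeff-≈ (minor-det-≤ a b a≤b) s))
      ; degree         = degree
      ; leading        = leading
      ; linear-sum     = linear-sum
      }

  module Cofactor> (a b : Fin n) (b<a : toℕ b < toℕ a) where
    open import Algebra.Solver.Ring.NaturalCoefficients.Default commutativeSemiring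

    α β : ℕ
    α = toℕ a
    β = toℕ b

    α≤ℓ : α ≤ ℓ
    α≤ℓ = F.toℕ≤pred[n] a

    β≤m : β ≤ m
    β≤m = ℕ.s≤s⁻¹ (ℕ.<-≤-trans b<a α≤ℓ)

    0<α : 0 < α
    0<α = ℕ.≤-<-trans z≤n b<a

    column : ℕ → ℕ
    column t = punchInℕ β (rotateℕ m t)

    linear : ℕ → Bool
    linear t = punchInℕ α t ℕ.≡ᵇ column t

    e c : ℕ → Carrier
    e t = Eℕ (punchInℕ α t)
    c t = - Kℕ (column t)

    isFactors : Factors (λ x → N (punchIn a x) (punchIn b (rotate x))) linear e c
    isFactors = labelled-factors (punchIn a) (punchIn b ∘ rotate) (punchInℕ α) column (toℕ-punchIn a)
      (λ x → ≡.trans (toℕ-punchIn b (rotate x)) (≡.cong (punchInℕ β) (toℕ-rotate x))) adjacent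
      where
      adjacent : ∀ t → t < ℓ → Adjacent (punchInℕ α t) (column t)
      adjacent zero    _ = corner (punchInℕ-< 0<α) (punchInℕ-≥ β≤m)
      adjacent (suc t) _ with suc t ℕ.<? α | t ℕ.<? β
      ... | yes 1+t<α | yes t<β =
        subdiagonal (≡.trans (punchInℕ-< 1+t<α) (≡.cong suc (≡.sym (punchInℕ-< t<β))))
      ... | yes 1+t<α | no  t≮β =
        diagonal (≡.trans (punchInℕ-< 1+t<α) (≡.sym (punchInℕ-≥ (ℕ.≮⇒≥ t≮β))))
      ... | no  1+t≮α | yes t<β = ⊥-elim (1+t≮α (ℕ.≤-<-trans t<β b<a))
      ... | no  1+t≮α | no  t≮β =
        subdiagonal (≡.trans (punchInℕ-≥ (ℕ.≮⇒≥ 1+t≮α))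
                             (≡.cong suc (≡.sym (punchInℕ-≥ (ℕ.≮⇒≥ t≮β)))))

    1+β+[α∸1+β]≡α : suc β ℕ.+ (α ∸ suc β) ≡ α
    1+β+[α∸1+β]≡α = ℕ.m+[n∸m]≡n b<a

    off-path<α : ∀ {s} → s < α ∸ suc β → suc β ℕ.+ s < α
    off-path<α s<α∸1+β = ≡.subst (_ <_) 1+β+[α∸1+β]≡α (ℕ.+-monoʳ-< (suc β) s<α∸1+β)

    path-shift : ∀ s → suc β ℕ.+ ((α ∸ suc β) ℕ.+ s) ≡ α ℕ.+ s
    path-shift s =
      ≡.trans (≡.sym (ℕ.+-assoc (suc β) (α ∸ suc β) s)) (≡.cong (ℕ._+ s) 1+β+[α∸1+β]≡α)

    column-after-path : ∀ s → column (suc β ℕ.+ ((α ∸ suc β) ℕ.+ s)) ≡ α ℕ.+ s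
    column-after-path s = ≡.trans (punchInℕ-≥ (ℕ.m≤m+n β _)) (path-shift s)

    blocks : #linear ℓ linear ≡ α ∸ suc β
             × constantPart ℓ linear c
                 ≈ prodℕ (suc β) c * prodℕ (ℓ ∸ α) (c ∘ (suc β ℕ.+_) ∘ ((α ∸ suc β) ℕ.+_))
             × linearSum ℓ linear e ≈ sumℕ (α ∸ suc β) (e ∘ (suc β ℕ.+_))
    blocks = false-true-false-blocks (suc β) (α ∸ suc β) (ℓ ∸ α) linear e c
      (≡.trans (path-shift (ℓ ∸ α)) (ℕ.m+[n∸m]≡n α≤ℓ)) on-path-before off-path on-path-after
      where
      on-path-before : ConstantOn (suc β) linear false
      on-path-before zero    _         = ≡ᵇ-false λ r≡c →
        ℕ.0≢1+n (≡.trans (≡.sym (punchInℕ-< 0<α)) (≡.trans r≡c (punchInℕ-≥ β≤m)))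
      on-path-before (suc t) (s≤s t<β) = ≡ᵇ-false λ r≡c →
        ℕ.1+n≢n (≡.trans (≡.sym (punchInℕ-< (ℕ.≤-<-trans t<β b<a))) (≡.trans r≡c (punchInℕ-< t<β)))
      off-path : ConstantOn (α ∸ suc β) (linear ∘ (suc β ℕ.+_)) true
      off-path s s<α∸1+β =
        ≡ᵇ-true (≡.trans (punchInℕ-< (off-path<α s<α∸1+β)) (≡.sym (punchInℕ-≥ (ℕ.m≤m+n β s))))
      on-path-after : ConstantOn (ℓ ∸ α) (linear ∘ (suc β ℕ.+_) ∘ ((α ∸ suc β) ℕ.+_)) false
      on-path-after s _ = ≡ᵇ-false λ r≡c →
        ℕ.1+n≢n (≡.trans (≡.sym row-label) (≡.trans r≡c (column-after-path s)))
        where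
        row-label : punchInℕ α (suc β ℕ.+ ((α ∸ suc β) ℕ.+ s)) ≡ suc (α ℕ.+ s)
        row-label = ≡.trans (≡.cong (punchInℕ α) (path-shift s)) (punchInℕ-≥ (ℕ.m≤m+n α s))

    degree : #linear ℓ linear ≡ steps (next b) a
    degree = ≡.trans (proj₁ blocks) (≡.sym (steps-next-> a b b<a))

    Kℓ Pβ Pα : Carrier
    Kℓ = Kℕ ℓ
    Pβ = prodℕ β Kℕ
    Pα = prodℕ (ℓ ∸ α) (λ s → Kℕ (α ℕ.+ s))

    κ≈ : κ k a b ≈ Kℓ * Pβ * Pα
    κ≈ = begin
      κ k a b
        ≈⟨ κ≈prodℕ a b ⟩
      prodℕ (steps a b) g
        ≡⟨ ≡.cong (λ L → prodℕ L g) steps≡ ⟩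
      prodℕ (suc (ℓ ∸ α) ℕ.+ β) g
        ≈⟨ prodℕ-+ (suc (ℓ ∸ α)) β g ⟩
      prodℕ (suc (ℓ ∸ α)) g * prodℕ β (g ∘ (suc (ℓ ∸ α) ℕ.+_))
        ≈⟨ *-cong (prodℕ-suc (ℓ ∸ α) g) (prodℕ-cong β λ s _ →
           reflexive (≡.trans (≡.cong Kℕ (wrap s)) (Kℕ-periodic s))) ⟩
      Pα * g (ℓ ∸ α) * Pβ
        ≡⟨ ≡.cong (λ q → Pα * Kℕ q * Pβ) (ℕ.m+[n∸m]≡n α≤ℓ) ⟩
      Pα * Kℓ * Pβ
        ≈⟨ solve 3 (λ x y z → x :* y :* z := y :* z :* x) refl Pα Kℓ Pβ ⟩
      Kℓ * Pβ * Pα ∎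
      where
      g : ℕ → Carrier
      g t = Kℕ (α ℕ.+ t)
      steps≡ : steps a b ≡ suc (ℓ ∸ α) ℕ.+ β
      steps≡ = ≡.trans (steps-> a b b<a)
        (≡.trans (ℕ.+-∸-comm β (ℕ.m≤n⇒m≤1+n α≤ℓ)) (≡.cong (ℕ._+ β) (ℕ.+-∸-assoc 1 α≤ℓ)))
      wrap : ∀ s → α ℕ.+ (suc (ℓ ∸ α) ℕ.+ s) ≡ n ℕ.+ s
      wrap s = ≡.trans (≡.sym (ℕ.+-assoc α (suc (ℓ ∸ α)) s))
                 (≡.cong (ℕ._+ s) (≡.trans (ℕ.+-suc α (ℓ ∸ α)) (≡.cong suc (ℕ.m+[n∸m]≡n α≤ℓ))))

    leading : sign (α ℕ.+ β ℕ.+ m) (constantPart ℓ linear c) ≈ κ k a b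
    leading = begin
      sign σ (constantPart ℓ linear c)
        ≈⟨ sign-cong σ (trans (proj₁ (proj₂ blocks)) (*-cong path-before-product path-after-product)) ⟩
      sign σ (sign (suc β) (Kℓ * Pβ) * sign (ℓ ∸ α) Pα)
        ≈⟨ sign-cong σ (trans (sign-*ˡ (suc β) _ _) (sign-cong (suc β) (sign-*ʳ (ℓ ∸ α) _ _))) ⟩
      sign σ (sign (suc β) (sign (ℓ ∸ α) (Kℓ * Pβ * Pα)))
        ≈⟨ sign-cong σ (sign-sign (suc β) (ℓ ∸ α) _) ⟩
      sign σ (sign (suc β ℕ.+ (ℓ ∸ α)) (Kℓ * Pβ * Pα))
        ≈⟨ sign-sign σ _ _ ⟩
      sign (σ ℕ.+ (suc β ℕ.+ (ℓ ∸ α))) (Kℓ * Pβ * Pα)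
        ≈⟨ sign-even _ (β ℕ.+ ℓ) _ even ⟩
      Kℓ * Pβ * Pα
        ≈⟨ κ≈ ⟨
      κ k a b ∎
      where
      σ : ℕ
      σ = α ℕ.+ β ℕ.+ m
      path-before-product : prodℕ (suc β) c ≈ sign (suc β) (Kℓ * Pβ)
      path-before-product = trans (prodℕ-neg (suc β) (Kℕ ∘ column))
        (sign-cong (suc β) (*-cong (reflexive (≡.cong Kℕ (punchInℕ-≥ β≤m)))
                                   (prodℕ-cong β λ t t<β → reflexive (≡.cong Kℕ (punchInℕ-< t<β)))))
      path-after-product :
        prodℕ (ℓ ∸ α) (c ∘ (suc β ℕ.+_) ∘ ((α ∸ suc β) ℕ.+_)) ≈ sign (ℓ ∸ α) Pα
      path-after-product =
        trans (prodℕ-cong (ℓ ∸ α) λ s _ → -‿cong (reflexive (≡.cong Kℕ (column-after-path s))))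
              (prodℕ-neg (ℓ ∸ α) (λ s → Kℕ (α ℕ.+ s)))
      rearrange : ∀ α β m D →
        α ℕ.+ β ℕ.+ m ℕ.+ (suc β ℕ.+ D) ≡ (α ℕ.+ D) ℕ.+ (β ℕ.+ (m ℕ.+ suc β))
      rearrange = solve-∀
      double : ∀ β m → suc m ℕ.+ (β ℕ.+ (m ℕ.+ suc β)) ≡ β ℕ.+ suc m ℕ.+ (β ℕ.+ suc m)
      double = solve-∀
      even : σ ℕ.+ (suc β ℕ.+ (ℓ ∸ α)) ≡ β ℕ.+ ℓ ℕ.+ (β ℕ.+ ℓ)
      even = ≡.trans (rearrange α β m (ℓ ∸ α))
               (≡.trans (≡.cong (ℕ._+ (β ℕ.+ (m ℕ.+ suc β))) (ℕ.m+[n∸m]≡n α≤ℓ)) (double β m))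

    linear-sum : linearSum ℓ linear e ≈ e1* Leak k k0 a b
    linear-sum = begin
      linearSum ℓ linear e
        ≈⟨ proj₂ (proj₂ blocks) ⟩
      sumℕ (α ∸ suc β) (e ∘ (suc β ℕ.+_))
        ≈⟨ sumℕ-cong (α ∸ suc β) (λ s s<α∸1+β → reflexive (≡.cong Eℕ
             (≡.trans (punchInℕ-< (off-path<α s<α∸1+β)) (≡.sym (ℕ.+-suc β s))))) ⟩
      sumℕ (α ∸ suc β) (λ t → Eℕ (β ℕ.+ suc t))
        ≡⟨ ≡.cong (λ L → sumℕ L (λ t → Eℕ (β ℕ.+ suc t))) (steps-next-> a b b<a) ⟨
      sumℕ (steps (next b) a) (λ t → Eℕ (β ℕ.+ suc t))
        ≈⟨ e1*≈sumℕ a b ⟨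
      e1* Leak k k0 a b ∎

    shape : CofactorShape a b
    shape = record
      { sgn            = α ℕ.+ β ℕ.+ m
      ; isFactors      = isFactors
      ; coeff-cofactor = λ s → trans (coeff-signP (α ℕ.+ β) _ s)
          (trans (sign-cong (α ℕ.+ β) (trans (coeff-≈ (minor-det-> a b b<a) s) (coeff-signP m _ s)))
                 (sign-sign (α ℕ.+ β) m _))
      ; degree         = degree
      ; leading        = leading
      ; linear-sum     = linear-sum
      }

  cofactorShape : ∀ (a b : Fin n) → CofactorShape a b
  cofactorShape a b with toℕ a ℕ.≤? toℕ b
  ... | yes a≤b = Cofactor≤.shape a b a≤b
  ... | no  a≰b = Cofactor>.shape a b (ℕ.≰⇒> a≰b)

  coeff-cofactor-leading : ∀ (a b : Fin n) → coeff (cofactor a b) (steps (next b) a) ≈ κ k a b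
  coeff-cofactor-leading a b = begin
    coeff (cofactor a b) (steps (next b) a)        ≈⟨ coeff-cofactor _ ⟩
    sign sgn (coeff (prodP f) (steps (next b) a))  ≡⟨ ≡.cong (λ s → sign sgn (coeff (prodP f) s)) degree ⟨
    sign sgn (coeff (prodP f) (#linear ℓ linear))  ≈⟨ sign-cong sgn (coeff-prodP-leading isFactors) ⟩
    sign sgn (constantPart ℓ linear c)             ≈⟨ leading ⟩
    κ k a b                                        ∎
    where open CofactorShape (cofactorShape a b)

  coeff-cofactor-subleading : ∀ (a b : Fin n) d → suc d ≡ steps (next b) a →
    coeff (cofactor a b) d ≈ e1* Leak k k0 a b * κ k a b
  coeff-cofactor-subleading a b d 1+d≡ = begin
    coeff (cofactor a b) d
      ≈⟨ coeff-cofactor d ⟩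
    sign sgn (coeff (prodP f) d)
      ≈⟨ sign-cong sgn (coeff-prodP-subleading isFactors d (≡.trans 1+d≡ (≡.sym degree))) ⟩
    sign sgn (constantPart ℓ linear c * linearSum ℓ linear e)
      ≈⟨ sign-*ˡ sgn _ _ ⟨
    sign sgn (constantPart ℓ linear c) * linearSum ℓ linear e
      ≈⟨ *-cong leading linear-sum ⟩
    κ k a b * e1* Leak k k0 a b
      ≈⟨ *-comm _ _ ⟩
    e1* Leak k k0 a b * κ k a b ∎
    where open CofactorShape (cofactorShape a b)

yCoefficient : ∀ {n} → Model n → ℕ → CoeffFun n
yCoefficient M d R k k0 = Alg.coeff R (Alg.det R (Alg.charMatrix R M k k0)) d

uCoefficient : ∀ {n} → Model n → Fin n → Fin n → ℕ → CoeffFun n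
uCoefficient M i o d R k k0 =
  Alg.coeff R (Alg.signP R (toℕ i ℕ.+ toℕ o) (Alg.det R (minor (Alg.charMatrix R M k k0) i o))) d

infix 4 _≈ᶠ_
_≈ᶠ_ : ∀ {n} → CoeffFun n → CoeffFun n → Set₁
f ≈ᶠ g = ∀ R k k0 → CommutativeRing._≈_ R (f R k k0) (g R k k0)

contains-y-coefficient : ∀ {n} (M : Model n) {o} → o ∈ Model.Out M →
  ∀ {d} → d < n → ∀ {f} → yCoefficient M d ≈ᶠ f → Contains M f
contains-y-coefficient M o∈Out {d} d<n {f} y≈f =
  yCoeff _ o∈Out (F.fromℕ< d<n) ,
  ≡.subst (λ d′ → yCoefficient M d′ ≈ᶠ f) (≡.sym (F.toℕ-fromℕ< d<n)) y≈f

contains-u-coefficient : ∀ {n} (M : Model n) {o i} → o ∈ Model.Out M → i ∈ Model.In M →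
  ∀ {d} → d < n → ∀ {f} → uCoefficient M i o d ≈ᶠ f → Contains M f
contains-u-coefficient M {o} {i} o∈Out i∈In {d} d<n {f} u≈f =
  uCoeff _ o∈Out _ i∈In (F.fromℕ< d<n) ,
  ≡.subst (λ d′ → uCoefficient M i o d′ ≈ᶠ f) (≡.sym (F.toℕ-fromℕ< d<n)) u≈f

proposition3p14 : (n : ℕ) → 3 ≤ n → (In Out Leak : Subset n) →
  Nonempty In → Nonempty Out → Nonempty Leak →
  ((d : ℕ) → 1 ≤ d → d < n →
    Contains (cycleModel In Out Leak)
      (λ R k k0 → Alg.esym R d (Alg.Eset R Leak k k0)))
  × Contains (cycleModel In Out Leak)
      (λ R k k0 → CommutativeRing._+_ R (Alg.esym R n (Alg.Eset R Leak k k0))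
                    (CommutativeRing.-_ R (Alg.prodR R (Alg.kc R k))))
  × ((i j : Fin n) → i ∈ In → j ∈ Out →
    Contains (cycleModel In Out Leak) (λ R k k0 → Alg.κ R k i j))
  × ((i j : Fin n) → i ∈ In → j ∈ Out → j ≢ prev i →
    Contains (cycleModel In Out Leak)
      (λ R k k0 → CommutativeRing._*_ R (Alg.e1* R Leak k k0 i j) (Alg.κ R k i j)))
proposition3p14 (suc (suc m)) (s≤s (s≤s _)) In Out Leak _ (o , o∈Out) _ =
    (λ d 1≤d d<n → contains-y-coefficient M o∈Out (ℕ.∸-monoʳ-< 1≤d (ℕ.<⇒≤ d<n)) λ R k k0 →
       Cycle.coeff-det-N-nonconstant R k k0 (n ∸ d) d (ℕ.m∸n+n≡m (ℕ.<⇒≤ d<n)) (ℕ.m<n⇒0<n∸m d<n))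
  , contains-y-coefficient M o∈Out ℕ.0<1+n Cycle.coeff-det-N-constant
  , (λ i j i∈In j∈Out → contains-u-coefficient M j∈Out i∈In (steps<n (next j) i) λ R k k0 →
       Cycle.coeff-cofactor-leading R k k0 i j)
  , (λ i j i∈In j∈Out j≢prev →
       contains-u-coefficient M j∈Out i∈In (ℕ.≤-<-trans ℕ.pred[n]≤n (steps<n (next j) i)) λ R k k0 →
         Cycle.coeff-cofactor-subleading R k k0 i j _
           (ℕ.suc-pred _ {{ℕ.≢-nonZero (steps-next≢0 i j j≢prev)}}))
  where
  open CycleIndex (suc m)
  M : Model n
  M = cycleModel In Out Leak
  module Cycle (R : CommutativeRing 0ℓ 0ℓ) (k : Fin n → Fin n → CommutativeRing.Carrier R)
               (k0 : Fin n → CommutativeRing.Carrier R) = CycleMatrix R m In Out Leak k k0
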